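{- Let $t$ be a fixed positive integer denoting the speed of the robber. There is a constant $c_t>0$, depending only on $t$, such that the following holds. If $G$ is a finite, simple, connected $d$-regular graph with $d \geq \max\{3,t\}$ and girth larger than $2t+2$, then the cop number of $G$ is at least $c_t d^t$; that is, the cop number is $\Omega(d^t)$.
   Context: Cops and Robbers with a robber of speed $t$ on a finite simple connected graph $G$: first the cops are placed on vertices of their choice (several cops may share a vertex); then the robber, knowing their positions, chooses a vertex. The cops and the robber then move alternately, cops first. On the cops' turn each cop either stays put or moves along an edge to an adjacent vertex. On the robber's turn she moves along any path of length at most $t$ from her current position (possibly staying put), but may not pass through a vertex occupied by a cop. The cops win if at some point a cop occupies the robber's vertex; otherwise the robber wins. The cop number of $G$ (for robber speed $t$) is the minimum number of cops that guarantees the cops can win. -}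

module Defs where

open import Data.Nat using (ℕ; zero; suc; _≤_; _+_)
open import Data.Fin using (Fin; toℕ) renaming (zero to fzero; suc to fsuc)
open import Data.Bool using (Bool; true; false)
open import Data.List using (List; length; filterᵇ)
open import Data.List using () renaming (allFin to allFinL)
open import Data.Product using (Σ; ∃; ∃-syntax; _×_; _,_)
open import Data.Sum using (_⊎_)
open import Relation.Binary.PropositionalEquality using (_≡_; _≢_)
open import Relation.Nullary using (¬_)
open import Function.Definitions using (Injective)

record Graph (n : ℕ) : Set where
  field
    adj   : Fin n → Fin n → Bool
    sym   : ∀ u v → adj u v ≡ adj v u
    irrefl : ∀ v → adj v v ≡ false
open Graph public

module _ {n : ℕ} (G : Graph n) where

  Adj : Fin n → Fin n → Set
  Adj u v = adj G u v ≡ true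

  data Walk : ℕ → Fin n → Fin n → Set where
    here : ∀ {v} → Walk 0 v v
    step : ∀ {ℓ u w v} → Adj u w → Walk ℓ w v → Walk (suc ℓ) u v

  Connected : Set
  Connected = ∀ u v → ∃[ ℓ ] Walk ℓ u v

  degree : Fin n → ℕ
  degree v = length (filterᵇ (adj G v) (allFinL n))

  Regular : ℕ → Set
  Regular d = ∀ v → degree v ≡ d

  IsCycle : (k : ℕ) → (Fin k → Fin n) → Set
  IsCycle k f = 3 ≤ k × Injective _≡_ _≡_ f
              × (∀ (i j : Fin k) → suc (toℕ i) ≡ toℕ j → Adj (f i) (f j))
              × (∀ (i j : Fin k) → suc (toℕ i) ≡ k → toℕ j ≡ 0 → Adj (f i) (f j))

  GirthGreaterThan : ℕ → Set
  GirthGreaterThan g = ∀ k → k ≤ g → (f : Fin k → Fin n) → ¬ IsCycle k f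

  module Game (t k : ℕ) where

    Cops : Set
    Cops = Fin k → Fin n

    Occupied : Cops → Fin n → Set
    Occupied c v = ∃[ i ] c i ≡ v

    CopStep : Cops → Cops → Set
    CopStep c c' = ∀ i → c' i ≡ c i ⊎ Adj (c i) (c' i)

    data RobStep (c : Cops) : ℕ → Fin n → Fin n → Set where
      stay : ∀ {s u} → RobStep c s u u
      go   : ∀ {s u w v} → Adj u w → ¬ Occupied c w → RobStep c s w v
           → RobStep c (suc s) u v

    -- CopWin c r : it is the cops' turn, cops at c, robber at r, and the
    -- cops can force capture in finitely many rounds (inductive winning region).
    data CopWin (c : Cops) (r : Fin n) : Set where
      caught : Occupied c r → CopWin c r
      move   : (c' : Cops) → CopStep c c'
             → (Occupied c' r ⊎ (∀ r' → RobStep c' t r r' → CopWin c' r'))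
             → CopWin c r

  CopsWin : (t k : ℕ) → Set
  CopsWin t k = ∃[ c ] (∀ r → Game.CopWin t k c r)

module Submission where

-- Write q = d - 1.  For a vertex u let S r u f be the
-- sum of f over the endpoints of the non-backtracking walks of length r
-- starting at u, and let N m u c = S m u (number of cops at ·).  Because the
-- girth exceeds 2t+2, two vertices are joined by at most one non-backtracking
-- walk of length ≤ t+1 (two of them would glue into a short cycle).
-- The robber at u is *safe* for the cop positions c if the potential
--     Φ = q^t (N₀ + N₁) + Λ Σ_{2≤j≤t} q^{t+1-j} N_j
-- is below q^t; then no cop is within distance one of her.  The proof shows
--   (1) some vertex is safe for the initial cop positions (averaging Φ over
--       all n ≥ q^{t+1} vertices), and
--   (2) if she is safe and the cops move, then averaging over the ≥ q^t
--       non-backtracking walks of length t from her position yields one that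
--       avoids all cops and ends at a safe vertex (the key inequality).

open import Defs hiding (sym)
open import Data.Nat
open import Data.Nat.Properties
open import Data.Nat.Tactic.RingSolver
open import Data.Fin using (Fin; toℕ; fromℕ<) renaming (zero to fzero; suc to fsuc)
open import Data.Fin.Properties using (toℕ-injective; toℕ<n) renaming (_≟_ to _≟F_; suc-injective to fsuc-injective)
open import Data.Bool using (Bool; true; false; _∧_; not) renaming (T to True)
open import Data.Maybe using (Maybe; just; nothing)
open import Data.List using (length; filterᵇ; tabulate)
open import Data.Product using (∃-syntax; _×_; _,_)
open import Data.Sum using (_⊎_; inj₁; inj₂)
open import Data.Empty using (⊥; ⊥-elim)
open import Function using (case_of_)
open import Relation.Binary.PropositionalEquality
open import Relation.Binary.Definitions using (tri<; tri≈; tri>)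
open import Relation.Nullary using (¬_; yes; no)
open import Algebra.Properties.CommutativeSemigroup +-commutativeSemigroup using (interchange)
open import Algebra.Properties.Semiring.Sum +-*-semiring using (sum; sum-cong-≗; ∑-distrib-+; ∑-comm; *-distribˡ-sum)

-- select b x is x if b holds and 0 otherwise; it turns Boolean tests into
-- summands, e.g. a sum over neighbours is a sum of select (adj u w) · over w.
select : Bool → ℕ → ℕ
select true x = x
select false x = 0

select-≤ : ∀ b x → select b x ≤ x
select-≤ true x = ≤-refl
select-≤ false x = z≤n

select-mono : ∀ b {x y} → x ≤ y → select b x ≤ select b y
select-mono true p = p
select-mono false p = z≤n

select-+ : ∀ b x y → select b (x + y) ≡ select b x + select b y
select-+ true x y = refl
select-+ false x y = refl

select-* : ∀ b c x → select b (c * x) ≡ c * select b x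
select-* true c x = refl
select-* false c x = sym (*-zeroʳ c)

eqᵇ : ∀ {m} → Fin m → Fin m → Bool
eqᵇ fzero fzero = true
eqᵇ fzero (fsuc j) = false
eqᵇ (fsuc i) fzero = false
eqᵇ (fsuc i) (fsuc j) = eqᵇ i j

eqᵇ-refl : ∀ {m} (i : Fin m) → eqᵇ i i ≡ true
eqᵇ-refl fzero = refl
eqᵇ-refl (fsuc i) = eqᵇ-refl i

eqᵇ⇒≡ : ∀ {m} (i j : Fin m) → eqᵇ i j ≡ true → i ≡ j
eqᵇ⇒≡ fzero fzero e = refl
eqᵇ⇒≡ fzero (fsuc j) ()
eqᵇ⇒≡ (fsuc i) fzero ()
eqᵇ⇒≡ (fsuc i) (fsuc j) e = cong fsuc (eqᵇ⇒≡ i j e)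

eqᵇ-sym : ∀ {m} (i j : Fin m) → eqᵇ i j ≡ eqᵇ j i
eqᵇ-sym fzero fzero = refl
eqᵇ-sym fzero (fsuc j) = refl
eqᵇ-sym (fsuc i) fzero = refl
eqᵇ-sym (fsuc i) (fsuc j) = eqᵇ-sym i j

sum-* : ∀ {m} (c : ℕ) (f : Fin m → ℕ) → sum (λ i → c * f i) ≡ c * sum f
sum-* c f = sym (*-distribˡ-sum c f)

sum-mono : ∀ {m} {f g : Fin m → ℕ} → (∀ i → f i ≤ g i) → sum f ≤ sum g
sum-mono {zero} e = z≤n
sum-mono {suc m} e = +-mono-≤ (e fzero) (sum-mono (λ i → e (fsuc i)))

sum-const : ∀ {m} (c : ℕ) → sum {m} (λ _ → c) ≡ m * c
sum-const {zero} c = refl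
sum-const {suc m} c = cong (c +_) (sum-const {m} c)

sum-point : ∀ {m} (u : Fin m) (g : Fin m → ℕ) → sum (λ y → select (eqᵇ u y) (g y)) ≡ g u
sum-point {suc m} fzero g = trans (cong (g fzero +_) (sum-const {m} 0)) (trans (cong (g fzero +_) (*-zeroʳ m)) (+-identityʳ _))
sum-point {suc m} (fsuc u) g = sum-point u (λ i → g (fsuc i))

term≤sum : ∀ {m} (f : Fin m → ℕ) (i : Fin m) → f i ≤ sum f
term≤sum f fzero = m≤m+n _ _
term≤sum f (fsuc i) = ≤-trans (term≤sum (λ j → f (fsuc j)) i) (m≤n+m _ (f fzero))

sum-pigeonhole : ∀ {m} (f g : Fin m → ℕ) → sum f < sum g → ∃[ i ] f i < g i
sum-pigeonhole {zero} f g ()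
sum-pigeonhole {suc m} f g lt with f fzero <? g fzero
... | yes p = fzero , p
... | no np with sum-pigeonhole (λ i → f (fsuc i)) (λ i → g (fsuc i)) (+-cancelˡ-< (g fzero) _ _ (≤-<-trans (+-monoˡ-≤ _ (≮⇒≥ np)) lt))
... | i , q = fsuc i , q

sum-pos : ∀ {m} (f : Fin m → ℕ) → 1 ≤ sum f → ∃[ i ] 1 ≤ f i
sum-pos {m} f h with sum-pigeonhole (λ _ → 0) f (≤-trans (≤-reflexive (cong suc (trans (sum-const {m} 0) (*-zeroʳ m)))) h)
... | i , p = i , p

sum-two : ∀ {m} (f : Fin m → ℕ) → 2 ≤ sum f →
  (∃[ i ] 2 ≤ f i) ⊎ (∃[ i ] ∃[ j ] (¬ (i ≡ j) × 1 ≤ f i × 1 ≤ f j))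
sum-two {zero} f ()
sum-two {suc m} f h with f fzero in eq
... | suc (suc x) = inj₁ (fzero , subst (2 ≤_) (sym eq) (s≤s (s≤s z≤n)))
... | suc zero with sum-pos (λ i → f (fsuc i)) (≤-pred h)
...   | j , p = inj₂ (fzero , fsuc j , (λ ()) , subst (1 ≤_) (sym eq) (s≤s z≤n) , p)
sum-two {suc m} f h | zero with sum-two (λ i → f (fsuc i)) h
... | inj₁ (i , p) = inj₁ (fsuc i , p)
... | inj₂ (i , j , ne , p , q) = inj₂ (fsuc i , fsuc j , (λ e → ne (fsuc-injective e)) , p , q)

sumTo : ℕ → (ℕ → ℕ) → ℕ
sumTo zero g = 0
sumTo (suc K) g = sumTo K g + g K

sumTo-cong : ∀ K {f g : ℕ → ℕ} → (∀ i → i < K → f i ≡ g i) → sumTo K f ≡ sumTo K g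
sumTo-cong zero e = refl
sumTo-cong (suc K) e = cong₂ _+_ (sumTo-cong K (λ i p → e i (m≤n⇒m≤1+n p))) (e K ≤-refl)

sumTo-mono : ∀ K {f g : ℕ → ℕ} → (∀ i → i < K → f i ≤ g i) → sumTo K f ≤ sumTo K g
sumTo-mono zero e = z≤n
sumTo-mono (suc K) e = +-mono-≤ (sumTo-mono K (λ i p → e i (m≤n⇒m≤1+n p))) (e K ≤-refl)

sumTo-+ : ∀ K (f g : ℕ → ℕ) → sumTo K (λ i → f i + g i) ≡ sumTo K f + sumTo K g
sumTo-+ zero f g = refl
sumTo-+ (suc K) f g rewrite sumTo-+ K f g = interchange (sumTo K f) (sumTo K g) (f K) (g K)

sumTo-* : ∀ K (c : ℕ) (f : ℕ → ℕ) → sumTo K (λ i → c * f i) ≡ c * sumTo K f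
sumTo-* zero c f = sym (*-zeroʳ c)
sumTo-* (suc K) c f rewrite sumTo-* K c f = sym (*-distribˡ-+ c (sumTo K f) (f K))

sumTo-const : ∀ K c → sumTo K (λ _ → c) ≡ K * c
sumTo-const zero c = refl
sumTo-const (suc K) c rewrite sumTo-const K c = +-comm (K * c) c

sumTo-bound : ∀ K (f : ℕ → ℕ) c → (∀ i → i < K → f i ≤ c) → sumTo K f ≤ K * c
sumTo-bound K f c h = ≤-trans (sumTo-mono K h) (≤-reflexive (sumTo-const K c))

sumTo-shift : ∀ K (f : ℕ → ℕ) → sumTo (suc K) f ≡ f 0 + sumTo K (λ i → f (suc i))
sumTo-shift zero f = +-comm 0 (f 0)
sumTo-shift (suc K) f rewrite sumTo-shift K f = +-assoc (f 0) _ _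

sum-sumTo : ∀ {m} K (f : Fin m → ℕ → ℕ) → sum (λ w → sumTo K (f w)) ≡ sumTo K (λ i → sum (λ w → f w i))
sum-sumTo {m} zero f = trans (sum-const {m} 0) (*-zeroʳ m)
sum-sumTo (suc K) f = trans (∑-distrib-+ (λ w → sumTo K (f w)) (λ w → f w K)) (cong (_+ sum (λ w → f w K)) (sum-sumTo K f))

term≤sumTo : ∀ K (f : ℕ → ℕ) i → i < K → f i ≤ sumTo K f
term≤sumTo (suc K) f i h with m≤n⇒m<n∨m≡n (≤-pred h)
... | inj₁ p = ≤-trans (term≤sumTo K f i p) (m≤m+n _ _)
... | inj₂ refl = m≤n+m _ _

length-filter : ∀ {m k} (p : Fin k → Bool) (g : Fin m → Fin k) →
  length (filterᵇ p (tabulate g)) ≡ sum (λ i → select (p (g i)) 1)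
length-filter {zero} p g = refl
length-filter {suc m} p g with p (g fzero)
... | true = cong suc (length-filter p (λ i → g (fsuc i)))
... | false = length-filter p (λ i → g (fsuc i))

select-1 : ∀ b c → select b c ≡ select b 1 * c
select-1 true c = sym (+-identityʳ c)
select-1 false c = refl

-- A walk is non-backtracking if it never
-- returns to the vertex it just left.  S r p u f sums f over the endpoints of
-- the non-backtracking walks of length r from u whose first step does not go
-- to p (p = nothing: no restriction); the recursion peels off the first step.
module WalkSums {n : ℕ} (G : Graph n) where

  A : Fin n → Fin n → Bool
  A = adj G

  allowed : Maybe (Fin n) → Fin n → Fin n → Bool
  allowed nothing u w = A u w
  allowed (just p) u w = A u w ∧ not (eqᵇ p w)

  S : ℕ → Maybe (Fin n) → Fin n → (Fin n → ℕ) → ℕ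
  S zero p u f = f u
  S (suc r) p u f = sum (λ w → select (allowed p u w) (S r (just u) w f))

  S-cong : ∀ r p u {f g : Fin n → ℕ} → (∀ y → f y ≡ g y) → S r p u f ≡ S r p u g
  S-cong zero p u e = e u
  S-cong (suc r) p u e = sum-cong-≗ (λ w → cong (select (allowed p u w)) (S-cong r (just u) w e))

  S-mono : ∀ r p u {f g : Fin n → ℕ} → (∀ y → f y ≤ g y) → S r p u f ≤ S r p u g
  S-mono zero p u e = e u
  S-mono (suc r) p u e = sum-mono (λ w → select-mono (allowed p u w) (S-mono r (just u) w e))

  S-+ : ∀ r p u (f g : Fin n → ℕ) → S r p u (λ y → f y + g y) ≡ S r p u f + S r p u g
  S-+ zero p u f g = refl
  S-+ (suc r) p u f g = trans (sum-cong-≗ (λ w → trans (cong (select (allowed p u w)) (S-+ r (just u) w f g)) (select-+ (allowed p u w) _ _)))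
                              (∑-distrib-+ {n} _ _)

  S-* : ∀ r p u c (f : Fin n → ℕ) → S r p u (λ y → c * f y) ≡ c * S r p u f
  S-* zero p u c f = refl
  S-* (suc r) p u c f = trans (sum-cong-≗ (λ w → trans (cong (select (allowed p u w)) (S-* r (just u) w c f)) (select-* (allowed p u w) c _)))
                              (sum-* {n} c _)

  S-0 : ∀ r p u → S r p u (λ _ → 0) ≡ 0
  S-0 r p u = trans (S-cong r p u (λ y → sym (*-zeroˡ 0))) (trans (S-* r p u 0 (λ _ → 0)) refl)

  S-sum : ∀ {k} r p u (f : Fin k → Fin n → ℕ) → S r p u (λ y → sum (λ i → f i y)) ≡ sum (λ i → S r p u (f i))
  S-sum zero p u f = refl
  S-sum {k} (suc r) p u f =
    trans (sum-cong-≗ (λ w → trans (cong (select (allowed p u w)) (S-sum r (just u) w f)) (select-sum (allowed p u w) (λ i → S r (just u) w (f i)))))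
          (∑-comm {n} {k} (λ w i → select (allowed p u w) (S r (just u) w (f i))))
    where
    select-sum : ∀ {k} b (h : Fin k → ℕ) → select b (sum h) ≡ sum (λ i → select b (h i))
    select-sum true h = refl
    select-sum {k} false h = sym (trans (sum-const {k} 0) (*-zeroʳ k))

  S-sumTo : ∀ K r p u (f : ℕ → Fin n → ℕ) → S r p u (λ y → sumTo K (λ i → f i y)) ≡ sumTo K (λ i → S r p u (f i))
  S-sumTo zero r p u f = S-0 r p u
  S-sumTo (suc K) r p u f = trans (S-+ r p u _ _) (cong (_+ S r p u (f K)) (S-sumTo K r p u f))

  allowed-≤ : ∀ p u w x → select (allowed p u w) x ≤ select (A u w) x
  allowed-≤ nothing u w x = ≤-refl
  allowed-≤ (just p) u w x with A u w
  ... | true = select-≤ _ x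
  ... | false = z≤n

  S-relax : ∀ r p u f → S r p u f ≤ S r nothing u f
  S-relax zero p u f = ≤-refl
  S-relax (suc r) p u f = sum-mono (λ w → allowed-≤ p u w _)

  sum-split-point : ∀ (a : Fin n → Bool) (h : Fin n → ℕ) (p : Fin n) →
    sum (λ y → select (a y) (h y)) ≡ sum (λ y → select (a y ∧ not (eqᵇ p y)) (h y)) + select (a p) (h p)
  sum-split-point a h p = trans (sum-cong-≗ pw) (trans (∑-distrib-+ {n} _ _) (cong (sum (λ y → select (a y ∧ not (eqᵇ p y)) (h y)) +_) (sum-point p (λ y → select (a y) (h y)))))
    where
    pw : ∀ y → select (a y) (h y) ≡ select (a y ∧ not (eqᵇ p y)) (h y) + select (eqᵇ p y) (select (a y) (h y))
    pw y with a y | eqᵇ p y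
    ... | true | true = refl
    ... | true | false = sym (+-identityʳ _)
    ... | false | true = refl
    ... | false | false = refl

  module Regular-d (d : ℕ) (reg : Regular G d) where

    neighbourSum : ∀ u c → sum (λ w → select (A u w) c) ≡ d * c
    neighbourSum u c = begin
      sum (λ w → select (A u w) c) ≡⟨ sum-cong-≗ (λ w → trans (select-1 (A u w) c) (*-comm _ c)) ⟩
      sum (λ w → c * select (A u w) 1) ≡⟨ sum-* {n} c _ ⟩
      c * sum (λ w → select (A u w) 1) ≡⟨ cong (c *_) (sym (length-filter (A u) (λ i → i))) ⟩
      c * degree G u ≡⟨ cong (c *_) (reg u) ⟩
      c * d ≡⟨ *-comm c d ⟩
      d * c ∎
      where open ≡-Reasoning

    S-upper : ∀ r p u c → S r p u (λ _ → c) ≤ d ^ r * c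
    S-upper zero p u c = ≤-reflexive (sym (+-identityʳ c))
    S-upper (suc r) p u c = begin
      sum (λ w → select (allowed p u w) (S r (just u) w (λ _ → c)))
        ≤⟨ sum-mono (λ w → ≤-trans (allowed-≤ p u w _) (select-mono (A u w) (S-upper r (just u) w c))) ⟩
      sum (λ w → select (A u w) (d ^ r * c)) ≡⟨ neighbourSum u _ ⟩
      d * (d ^ r * c) ≡⟨ sym (*-assoc d (d ^ r) c) ⟩
      d ^ suc r * c ∎
      where open ≤-Reasoning

    module LowerBounds (q : ℕ) (dq : d ≡ suc q) where
      allowedSum-lower : ∀ p u x → q * x ≤ sum (λ w → select (allowed p u w) x)
      allowedSum-lower nothing u x = ≤-trans (*-monoˡ-≤ x (≤-trans (n≤1+n q) (≤-reflexive (sym dq)))) (≤-reflexive (sym (neighbourSum u x)))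
      allowedSum-lower (just p) u x = +-cancelˡ-≤ x _ _ (begin
        x + q * x ≡⟨ sym (cong (_* x) dq) ⟩
        d * x ≡⟨ sym (neighbourSum u x) ⟩
        sum (λ y → select (A u y) x) ≡⟨ sum-split-point (A u) (λ _ → x) p ⟩
        sum (λ y → select (A u y ∧ not (eqᵇ p y)) x) + select (A u p) x ≤⟨ +-monoʳ-≤ _ (select-≤ (A u p) x) ⟩
        sum (λ y → select (allowed (just p) u y) x) + x ≡⟨ +-comm _ x ⟩
        x + sum (λ y → select (allowed (just p) u y) x) ∎)
        where open ≤-Reasoning

      S-lower : ∀ r p u c → q ^ r * c ≤ S r p u (λ _ → c)
      S-lower zero p u c = ≤-reflexive (+-identityʳ c)
      S-lower (suc r) p u c = begin
        q ^ suc r * c ≡⟨ *-assoc q (q ^ r) c ⟩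
        q * (q ^ r * c) ≤⟨ allowedSum-lower p u _ ⟩
        sum (λ w → select (allowed p u w) (q ^ r * c)) ≤⟨ sum-mono (λ w → select-mono (allowed p u w) (S-lower r (just u) w c)) ⟩
        sum (λ w → select (allowed p u w) (S r (just u) w (λ _ → c))) ∎
        where open ≤-Reasoning

    -- Prepending an edge to a non-backtracking walk of length m+1 gives either
    -- a non-backtracking walk of length m+2, or a backtrack followed by a
    -- walk of length m (at most d choices for the edge).
    S-extend : ∀ m u f → S 1 nothing u (λ w → S (suc m) nothing w f) ≤ S (suc (suc m)) nothing u f + d * S m nothing u f
    S-extend m u f = begin
      sum (λ w → select (A u w) (S (suc m) nothing w f))
        ≡⟨ sum-cong-≗ (λ w → trans (cong (select (A u w)) (sum-split-point (A w) (λ y → S m (just w) y f) u)) (select-+ (A u w) _ _)) ⟩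
      sum (λ w → select (A u w) (S (suc m) (just u) w f) + select (A u w) (select (A w u) (S m (just w) u f)))
        ≡⟨ ∑-distrib-+ {n} (λ w → select (A u w) (S (suc m) (just u) w f)) (λ w → select (A u w) (select (A w u) (S m (just w) u f))) ⟩
      S (suc (suc m)) nothing u f + sum (λ w → select (A u w) (select (A w u) (S m (just w) u f)))
        ≤⟨ +-monoʳ-≤ _ (sum-mono (λ w → select-mono (A u w) (≤-trans (select-≤ (A w u) _) (S-relax m (just w) u f)))) ⟩
      S (suc (suc m)) nothing u f + sum (λ w → select (A u w) (S m nothing u f)) ≡⟨ cong (S (suc (suc m)) nothing u f +_) (neighbourSum u _) ⟩
      S (suc (suc m)) nothing u f + d * S m nothing u f ∎
      where open ≤-Reasoning

    -- Concatenating a walk of length a with walks of length b: every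
    -- concatenation reduces, by cancelling s backtracks, to a non-backtracking
    -- walk of length a + b - 2s.  T m s u is S (m - 2s) u f when 2s ≤ m
    -- and 0 otherwise.
    module Concatenation (f : Fin n → ℕ) where
      T : ℕ → ℕ → Fin n → ℕ
      T m zero u = S m nothing u f
      T zero (suc s) u = 0
      T (suc zero) (suc s) u = 0
      T (suc (suc m)) (suc s) u = T m s u

      T-step : ∀ m s u → S 1 nothing u (λ w → T m s w) ≤ T (suc m) s u + d * T (suc m) (suc s) u
      T-step zero zero u = m≤m+n _ _
      T-step (suc m) zero u = S-extend m u f
      T-step zero (suc s) u = ≤-trans (≤-reflexive (S-0 1 nothing u)) z≤n
      T-step (suc zero) (suc s) u = ≤-trans (≤-reflexive (S-0 1 nothing u)) z≤n
      T-step (suc (suc m)) (suc s) u = T-step m s u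

      S-prefix : ∀ a u h → S (suc a) nothing u h ≤ S 1 nothing u (λ w → S a nothing w h)
      S-prefix a u h = sum-mono (λ w → select-mono (A u w) (S-relax a (just u) w h))

      P : ℕ → ℕ → Fin n → ℕ
      P a b u = S a nothing u (λ y → S b nothing y f)

      -- P a b u ≤ 2^a Σ_{s≤a} d^s T (a+b) s u: the 2^a accounts for which of
      -- the a steps backtrack, d^s for the choices made at backtracking steps.
      concat-bound : ∀ a b u → P a b u ≤ 2 ^ a * sumTo (suc a) (λ s → d ^ s * T (a + b) s u)
      concat-bound zero b u = ≤-reflexive (sym (trans (+-identityʳ _) (+-identityʳ _)))
      concat-bound (suc a) b u = begin
        P (suc a) b u ≤⟨ S-prefix a u _ ⟩
        S 1 nothing u (λ w → P a b w) ≤⟨ S-mono 1 nothing u (λ w → concat-bound a b w) ⟩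
        S 1 nothing u (λ w → 2 ^ a * sumTo (suc a) (λ s → d ^ s * T (a + b) s w)) ≡⟨ S-* 1 nothing u (2 ^ a) _ ⟩
        2 ^ a * S 1 nothing u (λ w → sumTo (suc a) (λ s → d ^ s * T (a + b) s w))
          ≡⟨ cong (2 ^ a *_) (S-sumTo (suc a) 1 nothing u (λ s w → d ^ s * T (a + b) s w)) ⟩
        2 ^ a * sumTo (suc a) (λ s → S 1 nothing u (λ w → d ^ s * T (a + b) s w))
          ≤⟨ *-monoʳ-≤ (2 ^ a) (sumTo-mono (suc a) (λ s _ → ≤-trans (≤-reflexive (S-* 1 nothing u (d ^ s) _)) (*-monoʳ-≤ (d ^ s) (T-step (a + b) s u)))) ⟩
        2 ^ a * sumTo (suc a) (λ s → d ^ s * (T' s + d * T' (suc s)))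
          ≡⟨ cong (2 ^ a *_) (trans (sumTo-cong (suc a) (λ s _ → trans (*-distribˡ-+ (d ^ s) _ _) (cong (g s +_) (trans (sym (*-assoc (d ^ s) d _)) (cong (_* T' (suc s)) (*-comm (d ^ s) d)))))) (sumTo-+ (suc a) g (λ s → g (suc s)))) ⟩
        2 ^ a * (sumTo (suc a) g + sumTo (suc a) (λ s → g (suc s)))
          ≤⟨ *-monoʳ-≤ (2 ^ a) (+-mono-≤ (m≤m+n (sumTo (suc a) g) (g (suc a))) (≤-trans (m≤n+m _ (g 0)) (≤-reflexive (sym (sumTo-shift (suc a) g))))) ⟩
        2 ^ a * (sumTo (suc (suc a)) g + sumTo (suc (suc a)) g) ≡⟨ cong (2 ^ a *_) (cong (sumTo (suc (suc a)) g +_) (sym (+-identityʳ _))) ⟩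
        2 ^ a * (2 * sumTo (suc (suc a)) g) ≡⟨ sym (*-assoc (2 ^ a) 2 _) ⟩
        2 ^ a * 2 * sumTo (suc (suc a)) g ≡⟨ cong (_* sumTo (suc (suc a)) g) (*-comm (2 ^ a) 2) ⟩
        2 ^ suc a * sumTo (suc (suc a)) g ∎
        where
        open ≤-Reasoning
        T' : ℕ → ℕ
        T' s = T (suc (a + b)) s u
        g : ℕ → ℕ
        g s = d ^ s * T' s

      T-value : ∀ m s u → T m s u ≡ 0 ⊎ ∃[ m' ] (m' + (s + s) ≡ m × T m s u ≡ S m' nothing u f)
      T-value m zero u = inj₂ (m , +-identityʳ m , refl)
      T-value zero (suc s) u = inj₁ refl
      T-value (suc zero) (suc s) u = inj₁ refl
      T-value (suc (suc m)) (suc s) u with T-value m s u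
      ... | inj₁ e = inj₁ e
      ... | inj₂ (m' , e , e') = inj₂ (m' , trans (+-suc m' (s + suc s)) (cong suc (trans (cong (m' +_) (+-suc s s)) (trans (+-suc m' (s + s)) (cong suc e)))) , e')

-- A closed non-backtracking walk contains a cycle no
-- longer than itself; two different non-backtracking walks with the same ends
-- glue into such a closed walk.
module Cycles {n : ℕ} (G : Graph n) where

  A : Fin n → Fin n → Bool
  A = adj G

  findValue : (g : ℕ → Fin n) (s : ℕ) (y : Fin n) → (∃[ i ] (i < s × g i ≡ y)) ⊎ (∀ i → i < s → ¬ g i ≡ y)
  findValue g zero y = inj₂ (λ i ())
  findValue g (suc s) y with findValue g s y
  ... | inj₁ (i , p , e) = inj₁ (i , m≤n⇒m≤1+n p , e)
  ... | inj₂ no1 with g s ≟F y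
  ...   | yes e = inj₁ (s , ≤-refl , e)
  ...   | no ne = inj₂ λ i p e → case (m≤n⇒m<n∨m≡n (≤-pred p)) e
    where
    case : ∀ {i} → i < s ⊎ i ≡ s → g i ≡ y → ⊥
    case (inj₁ q) e = no1 _ q e
    case (inj₂ refl) e = ne e

  findRepeat : (g : ℕ → Fin n) (s : ℕ) → (∃[ i ] ∃[ j ] (i < j × j < s × g i ≡ g j)) ⊎ (∀ i j → i < j → j < s → ¬ g i ≡ g j)
  findRepeat g zero = inj₂ (λ i j _ ())
  findRepeat g (suc s) with findRepeat g s
  ... | inj₁ (i , j , p , q , e) = inj₁ (i , j , p , m≤n⇒m≤1+n q , e)
  ... | inj₂ nd with findValue g s (g s)
  ...   | inj₁ (i , p , e) = inj₁ (i , s , p , ≤-refl , e)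
  ...   | inj₂ ne = inj₂ λ i j p q e → case j (m≤n⇒m<n∨m≡n (≤-pred q)) p e
    where
    case : ∀ {i} j → j < s ⊎ j ≡ s → i < j → g i ≡ g j → ⊥
    case j (inj₁ r) p e = nd _ j p r e
    case j (inj₂ refl) p e = ne _ p e

  HasCycle : ℕ → Set
  HasCycle s = ∃[ K ] (K ≤ s × ∃[ f ] IsCycle G K f)

  hasCycle-mono : ∀ {s s'} → s ≤ s' → HasCycle s → HasCycle s'
  hasCycle-mono s≤s' (K , K≤s , cycle) = K , ≤-trans K≤s s≤s' , cycle

  module ClosedWalk (h : ℕ → Fin n) (L : ℕ)
             (adjP : ∀ i → i < L → A (h i) (h (suc i)) ≡ true)
             (nbP : ∀ i → suc (suc i) ≤ L → ¬ (h (suc (suc i)) ≡ h i)) where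

    segment-cycle : ∀ s a → 3 ≤ s → a + s ≤ L → h a ≡ h (a + s) →
            (∀ i j → i < j → j < s → ¬ h (a + i) ≡ h (a + j)) → IsCycle G s (λ k → h (a + toℕ k))
    segment-cycle s a s3 aL e nd = s3 , inj , adjC , closeC
      where
      inj : ∀ {x y : Fin s} → h (a + toℕ x) ≡ h (a + toℕ y) → x ≡ y
      inj {x} {y} eq with <-cmp (toℕ x) (toℕ y)
      ... | tri< lt _ _ = ⊥-elim (nd _ _ lt (toℕ<n y) eq)
      ... | tri≈ _ e' _ = toℕ-injective e'
      ... | tri> _ _ gt = ⊥-elim (nd _ _ gt (toℕ<n x) (sym eq))
      lt-L : ∀ (x : Fin s) → a + toℕ x < L
      lt-L x = ≤-trans (+-monoʳ-< a (toℕ<n x)) aL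
      adjC : ∀ (x y : Fin s) → suc (toℕ x) ≡ toℕ y → Adj G (h (a + toℕ x)) (h (a + toℕ y))
      adjC x y e' = subst (λ z → A (h (a + toℕ x)) (h z) ≡ true) (trans (sym (+-suc a (toℕ x))) (cong (a +_) e')) (adjP _ (lt-L x))
      closeC : ∀ (x y : Fin s) → suc (toℕ x) ≡ s → toℕ y ≡ 0 → Adj G (h (a + toℕ x)) (h (a + toℕ y))
      closeC x y e1 e2 = subst (λ z → A (h (a + toℕ x)) z ≡ true)
        (trans (cong h (trans (sym (+-suc a (toℕ x))) (cong (a +_) e1))) (trans (sym e) (trans (cong h (sym (+-identityʳ a))) (cong (λ z → h (a + z)) (sym e2)))))
        (adjP _ (lt-L x))

    -- A closed segment of length s ≥ 1 contains a cycle of length ≤ s: take an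
    -- innermost repetition (recursion on fuel ≥ s); it has length ≥ 3 since
    -- G has no loops and h does not backtrack.
    closedWalk-cycle : ∀ fuel s a → s ≤ fuel → 1 ≤ s → a + s ≤ L → h a ≡ h (a + s) → HasCycle s
    closedWalk-cycle zero s a sf s1 aL e = ⊥-elim (<⇒≱ s1 sf)
    closedWalk-cycle (suc fuel) s a sf s1 aL e with findRepeat (λ i → h (a + i)) s
    ... | inj₁ (i , j , ij , js , e') =
      hasCycle-mono (≤-trans (m∸n≤m j i) (<⇒≤ js))
        (closedWalk-cycle fuel (j ∸ i) (a + i) (≤-pred (≤-trans (s≤s (m∸n≤m j i)) (≤-trans js sf))) (m<n⇒0<n∸m ij)
           (≤-trans (≤-reflexive shift) (≤-trans (+-monoʳ-≤ a (<⇒≤ js)) aL)) (trans e' (cong h (sym shift))))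
      where
      shift : a + i + (j ∸ i) ≡ a + j
      shift = trans (+-assoc a i (j ∸ i)) (cong (a +_) (m+[n∸m]≡n (<⇒≤ ij)))
    ... | inj₂ nd = s , ≤-refl , _ , segment-cycle s a (length≥3 s s1 aL e) aL e nd
      where
      length≥3 : ∀ s → 1 ≤ s → a + s ≤ L → h a ≡ h (a + s) → 3 ≤ s
      length≥3 (suc zero) _ aL e = ⊥-elim (irr (subst (λ z → A (h a) z ≡ true) (sym (trans e (cong h (+-comm a 1)))) (adjP a (≤-trans (≤-reflexive (+-comm 1 a)) aL))))
        where
        irr : A (h a) (h a) ≡ true → ⊥
        irr q with trans (sym q) (irrefl G (h a))
        ... | ()
      length≥3 (suc (suc zero)) _ aL e = ⊥-elim (nbP a (≤-trans (≤-reflexive (+-comm 2 a)) aL) (trans (cong h (+-comm 2 a)) (sym e)))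
      length≥3 (suc (suc (suc s))) _ _ _ = s≤s (s≤s (s≤s z≤n))

  record NonBacktracking (m : ℕ) (u x : Fin n) (h : ℕ → Fin n) : Set where
    field
      h0 : h 0 ≡ u
      hm : h m ≡ x
      adjW : ∀ i → i < m → A (h i) (h (suc i)) ≡ true
      nbW : ∀ i → suc (suc i) ≤ m → ¬ (h (suc (suc i)) ≡ h i)

  sub-suc : ∀ M k → suc k ≤ M → M ∸ k ≡ suc (M ∸ suc k)
  sub-suc (suc M) zero _ = refl
  sub-suc (suc M) (suc k) (s≤s p) = sub-suc M k p

  split-at : ∀ i M → i < M ⊎ ∃[ j ] i ≡ M + j
  split-at i zero = inj₂ (i , refl)
  split-at zero (suc M) = inj₁ (s≤s z≤n)
  split-at (suc i) (suc M) with split-at i M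
  ... | inj₁ p = inj₁ (s≤s p)
  ... | inj₂ (j , e) = inj₂ (j , cong suc e)

  adj-sym : ∀ u v → A u v ≡ true → A v u ≡ true
  adj-sym u v e = trans (Graph.sym G v u) e

  -- glued follows h1 up to index M, then h2 backwards from index M
  module Glue (M : ℕ) (h1 h2 : ℕ → Fin n) where
    glued : ℕ → Fin n
    glued i with i ≤ᵇ M
    ... | true = h1 i
    ... | false = h2 (M ∸ (i ∸ M))

    glued-left : ∀ i → i ≤ M → glued i ≡ h1 i
    glued-left i p with i ≤ᵇ M | ≤⇒≤ᵇ p
    ... | true | _ = refl

    glued-right : ∀ j → glued (M + suc j) ≡ h2 (M ∸ suc j)
    glued-right j with (M + suc j) ≤ᵇ M in eq
    ... | true = ⊥-elim (<⇒≱ (m<m+n M (s≤s z≤n)) (≤ᵇ⇒≤ (M + suc j) M (subst True (sym eq) _)))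
    ... | false = cong (λ z → h2 (M ∸ z)) (m+n∸m≡n M (suc j))

  nb-restrict : ∀ {m u x h} (k : ℕ) → k ≤ m → NonBacktracking m u x h → NonBacktracking k u (h k) h
  nb-restrict k km w = record { h0 = NonBacktracking.h0 w ; hm = refl
                           ; adjW = λ i p → NonBacktracking.adjW w i (≤-trans p km)
                           ; nbW = λ i p → NonBacktracking.nbW w i (≤-trans p km) }

  -- Two non-backtracking walks u → x of length M = k + 2 whose second-to-last
  -- vertices differ glue (the first forwards, the second backwards) into a
  -- closed non-backtracking walk of length 2M, which contains a cycle.
  module Fork (k : ℕ) {u x : Fin n} (h1 h2 : ℕ → Fin n)
              (w1 : NonBacktracking (suc (suc k)) u x h1) (w2 : NonBacktracking (suc (suc k)) u x h2)
              (ne2 : ¬ h1 (suc k) ≡ h2 (suc k)) where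
    M L : ℕ
    M = suc (suc k)
    L = M + M
    open Glue M h1 h2
    open NonBacktracking
    hM : h1 M ≡ h2 M
    hM = trans (hm w1) (sym (hm w2))
    glued-closed : glued 0 ≡ glued (0 + L)
    glued-closed = trans (glued-left 0 z≤n) (trans (h0 w1) (trans (sym (h0 w2)) (trans (cong h2 (sym (n∸n≡0 M))) (sym (glued-right (suc k))))))
    glued-adj : ∀ i → i < L → A (glued i) (glued (suc i)) ≡ true
    glued-adj i lt with split-at i M
    ... | inj₁ p = subst₂ (λ a b → A a b ≡ true) (sym (glued-left i (<⇒≤ p))) (sym (glued-left (suc i) p)) (adjW w1 i p)
    ... | inj₂ (zero , refl) =
      subst₂ (λ a b → A a b ≡ true) (trans (sym hM) (trans (cong h1 (sym (+-identityʳ M))) (sym (glued-left (M + 0) (≤-reflexive (+-identityʳ M))))))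
             (trans (sym (glued-right 0)) (cong glued (+-suc M 0)))
             (adj-sym _ _ (adjW w2 (suc k) ≤-refl))
    ... | inj₂ (suc j , refl) =
      let jM : suc (suc j) ≤ M
          jM = +-cancelˡ-≤ M _ _ (≤-trans (≤-reflexive (+-suc M (suc j))) lt)
          r = M ∸ suc (suc j)
      in subst₂ (λ a b → A a b ≡ true)
           (trans (cong h2 (sym (sub-suc M (suc j) jM))) (sym (glued-right j)))
           (trans (sym (glued-right (suc j))) (cong glued (+-suc M (suc j))))
           (adj-sym _ _ (adjW w2 r (s≤s (≤-trans (m∸n≤m k j) (n≤1+n k)))))
    glued-nb : ∀ i → suc (suc i) ≤ L → ¬ (glued (suc (suc i)) ≡ glued i)
    glued-nb i lt with split-at i M
    ... | inj₁ p with m≤n⇒m<n∨m≡n p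
    ...   | inj₁ q = λ e → nbW w1 i q (trans (sym (glued-left (suc (suc i)) q)) (trans e (glued-left i (<⇒≤ p))))
    glued-nb .(suc k) lt | inj₁ p | inj₂ refl = λ e → ne2 (sym (trans (sym (glued-right 0)) (trans (cong glued (+-comm M 1)) (trans e (glued-left (suc k) (n≤1+n _))))))
    glued-nb i lt | inj₂ (zero , refl) = λ e → nbW w2 k ≤-refl
      (trans (sym hM) (trans (cong h1 (sym (+-identityʳ M))) (trans (sym (glued-left (M + 0) (≤-reflexive (+-identityʳ M))))
        (trans (sym e) (trans (cong glued (sym (trans (+-suc M 1) (cong suc (+-suc M 0))))) (glued-right 1))))))
    glued-nb i lt | inj₂ (suc j , refl) =
      let jM : suc (suc (suc j)) ≤ M
          jM = +-cancelˡ-≤ M _ _ (≤-trans (≤-reflexive (trans (+-suc M (suc (suc j))) (cong suc (+-suc M (suc j))))) lt)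
          r = M ∸ suc (suc (suc j))
          e1 : M ∸ suc j ≡ suc (suc r)
          e1 = trans (sub-suc M (suc j) (≤-trans (n≤1+n _) jM)) (cong suc (sub-suc M (suc (suc j)) jM))
      in λ e → nbW w2 r (≤-trans (≤-reflexive (sym e1)) (m∸n≤m M (suc j)))
           (trans (cong h2 (sym e1)) (trans (sym (glued-right j)) (trans (sym e) (trans (cong glued (sym (trans (+-suc M (suc (suc j))) (cong suc (+-suc M (suc j)))))) (glued-right (suc (suc j)))))))

    fork-cycle : HasCycle (M + M)
    fork-cycle = ClosedWalk.closedWalk-cycle glued L glued-adj glued-nb L L 0 ≤-refl (s≤s z≤n) ≤-refl glued-closed

  forking-cycle : ∀ m' h1 h2 u x → NonBacktracking (suc m') u x h1 → NonBacktracking (suc m') u x h2 → ¬ (h1 1 ≡ h2 1) → HasCycle (suc m' + suc m')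
  forking-cycle zero h1 h2 u x w1 w2 ne = ⊥-elim (ne (trans (NonBacktracking.hm w1) (sym (NonBacktracking.hm w2))))
  forking-cycle (suc k) h1 h2 u x w1 w2 ne with h1 (suc k) ≟F h2 (suc k)
  ... | yes e = hasCycle-mono (+-mono-≤ (n≤1+n (suc k)) (n≤1+n (suc k)))
    (forking-cycle k h1 h2 u (h1 (suc k)) (nb-restrict (suc k) (n≤1+n _) w1)
       (subst (λ z → NonBacktracking (suc k) u z h2) (sym e) (nb-restrict (suc k) (n≤1+n _) w2)) ne)
  ... | no ne2 = Fork.fork-cycle k h1 h2 w1 w2 ne2

-- indicator x y = 1 if x = y and 0 otherwise; S m p u (indicator x) counts
-- the non-backtracking walks from u to x.
indicator : ∀ {n} → Fin n → Fin n → ℕ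
indicator x y = select (eqᵇ x y) 1

indicator≤1 : ∀ {n} (x y : Fin n) → indicator x y ≤ 1
indicator≤1 x y = select-≤ (eqᵇ x y) 1

module UniqueWalks {n : ℕ} (G : Graph n) where
  open WalkSums G
  open Cycles G hiding (A)

  prepend : Fin n → (ℕ → Fin n) → ℕ → Fin n
  prepend u h zero = u
  prepend u h (suc i) = h i

  prepend-nb : ∀ {m u w x h} → A u w ≡ true → NonBacktracking m w x h → (1 ≤ m → ¬ h 1 ≡ u) → NonBacktracking (suc m) u x (prepend u h)
  prepend-nb {m} {u} {w} {x} {h} a wk pv = record { h0 = refl ; hm = NonBacktracking.hm wk ; adjW = adjW' ; nbW = nbW' }
    where
    adjW' : ∀ i → i < suc m → A (prepend u h i) (prepend u h (suc i)) ≡ true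
    adjW' zero _ = subst (λ z → A u z ≡ true) (sym (NonBacktracking.h0 wk)) a
    adjW' (suc i) (s≤s p) = NonBacktracking.adjW wk i p
    nbW' : ∀ i → suc (suc i) ≤ suc m → ¬ (prepend u h (suc (suc i)) ≡ prepend u h i)
    nbW' zero (s≤s p) = pv p
    nbW' (suc i) (s≤s p) = NonBacktracking.nbW wk i p

  allowed⇒adj : ∀ p u w → allowed p u w ≡ true → A u w ≡ true
  allowed⇒adj nothing u w e = e
  allowed⇒adj (just p) u w e with A u w
  ... | true = refl
  ... | false = e

  allowed⇒≢ : ∀ p u w → allowed (just p) u w ≡ true → ¬ w ≡ p
  allowed⇒≢ p u w e refl with A u p | eqᵇ-refl p
  ... | true | q rewrite q = case e of λ ()
  ... | false | q = case e of λ ()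

  select-pos : ∀ b x → 1 ≤ select b x → b ≡ true × 1 ≤ x
  select-pos true x p = refl , p
  select-pos false x ()

  walk-from-count : ∀ m p u x → 1 ≤ S m p u (indicator x) →
    ∃[ h ] (NonBacktracking m u x h × (∀ p' → p ≡ just p' → 1 ≤ m → ¬ h 1 ≡ p'))
  walk-from-count zero p u x q with eqᵇ x u in e
  ... | true = (λ _ → u) , record { h0 = refl ; hm = sym (eqᵇ⇒≡ x u e) ; adjW = λ i () ; nbW = λ i () } , λ p' _ ()
  walk-from-count zero p u x () | false
  walk-from-count (suc m) p u x q with sum-pos _ q
  ... | w , q' with select-pos (allowed p u w) _ q'
  ... | allowed-w , q'' with walk-from-count m (just u) w x q''
  ... | h' , wk , pv = prepend u h' , prepend-nb (allowed⇒adj p u w allowed-w) wk (λ lt → pv u refl lt) , avoids-p p allowed-w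
    where
    avoids-p : ∀ p → allowed p u w ≡ true → ∀ p' → p ≡ just p' → 1 ≤ suc m → ¬ prepend u h' 1 ≡ p'
    avoids-p .(just p') ok1 p' refl _ e = allowed⇒≢ p' u w ok1 (trans (sym (NonBacktracking.h0 wk)) e)

  count≥2⇒cycle : ∀ m p u x → 2 ≤ S m p u (indicator x) → HasCycle (m + m)
  count≥2⇒cycle zero p u x q = ⊥-elim (<⇒≱ q (indicator≤1 x u))
  count≥2⇒cycle (suc m) p u x q with sum-two _ q
  ... | inj₁ (w , q') with select-pos (allowed p u w) _ (≤-trans (s≤s z≤n) q')
  ... | allowed-w , _ = hasCycle-mono (+-mono-≤ (n≤1+n m) (n≤1+n m))
    (count≥2⇒cycle m (just u) w x (subst (λ b → 2 ≤ select b _) allowed-w q'))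
  count≥2⇒cycle (suc m) p u x q | inj₂ (w1 , w2 , ne , q1 , q2) with select-pos (allowed p u w1) _ q1 | select-pos (allowed p u w2) _ q2
  ... | ok1 , r1 | ok2 , r2 with walk-from-count m (just u) w1 x r1 | walk-from-count m (just u) w2 x r2
  ... | h1 , wk1 , pv1 | h2 , wk2 , pv2 =
    forking-cycle m (prepend u h1) (prepend u h2) u x
       (prepend-nb (allowed⇒adj p u w1 ok1) wk1 (λ lt → pv1 u refl lt))
       (prepend-nb (allowed⇒adj p u w2 ok2) wk2 (λ lt → pv2 u refl lt))
       (λ e → ne (trans (sym (NonBacktracking.h0 wk1)) (trans e (NonBacktracking.h0 wk2))))

  walkCount≤1 : ∀ t → GirthGreaterThan G (2 * t + 2) → ∀ m p u x → m ≤ suc t → S m p u (indicator x) ≤ 1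
  walkCount≤1 t gg m p u x mt with 2 ≤? S m p u (indicator x)
  ... | no np = ≤-pred (≰⇒> np)
  ... | yes q with count≥2⇒cycle m p u x q
  ... | K , Km , f , cyc = ⊥-elim (gg K (≤-trans Km (≤-trans (+-mono-≤ mt mt) (≤-reflexive (2t+2 t)))) f cyc)
    where
    2t+2 : ∀ t → suc t + suc t ≡ 2 * t + 2
    2t+2 = solve-∀

module Counting {n : ℕ} (G : Graph n) (d : ℕ) (reg : Regular G d) where
  open WalkSums G
  open Regular-d d reg
  open UniqueWalks G

  S-power : ∀ a b p u h B → (∀ y → S b nothing y h ≤ B) → S (a + b) p u h ≤ d ^ a * B
  S-power zero b p u h B hb = ≤-trans (S-relax b p u h) (≤-trans (hb u) (≤-reflexive (sym (+-identityʳ B))))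
  S-power (suc a) b p u h B hb = begin
    sum (λ w → select (allowed p u w) (S (a + b) (just u) w h))
      ≤⟨ sum-mono (λ w → ≤-trans (allowed-≤ p u w _) (select-mono (A u w) (S-power a b (just u) w h B hb))) ⟩
    sum (λ w → select (A u w) (d ^ a * B)) ≡⟨ neighbourSum u _ ⟩
    d * (d ^ a * B) ≡⟨ sym (*-assoc d (d ^ a) B) ⟩
    d ^ suc a * B ∎
    where open ≤-Reasoning

  module HighGirth (t : ℕ) (gg : GirthGreaterThan G (2 * t + 2)) where
    walkCount-bound : ∀ m u x → S m nothing u (indicator x) ≤ d ^ (m ∸ suc t)
    walkCount-bound m u x with m ≤? suc t
    ... | yes mt = ≤-trans (walkCount≤1 t gg m nothing u x mt) (≤-reflexive (cong (d ^_) (sym (m≤n⇒m∸n≡0 mt))))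
    ... | no mt = let a = m ∸ suc t
                      e : a + suc t ≡ m
                      e = m∸n+n≡m (<⇒≤ (≰⇒> mt))
                  in subst (λ z → S z nothing u (indicator x) ≤ d ^ a)
                       e (≤-trans (S-power a (suc t) nothing u (indicator x) 1 (λ y → walkCount≤1 t gg (suc t) nothing y x ≤-refl)) (≤-reflexive (*-identityʳ _)))

    indicator-sum : ∀ (y : Fin n) → sum (λ x → indicator x y) ≡ 1
    indicator-sum y = trans (sum-cong-≗ (λ x → cong (λ b → select b 1) (eqᵇ-sym x y))) (sum-point y (λ _ → 1))

    -- the walks of length ≤ t+1 from v end at distinct vertices, so there are
    -- at most n of them
    ball≤n : ∀ r p v → r ≤ suc t → S r p v (λ _ → 1) ≤ n
    ball≤n r p v rt = begin
      S r p v (λ _ → 1) ≡⟨ S-cong r p v (λ y → sym (indicator-sum y)) ⟩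
      S r p v (λ y → sum (λ x → indicator x y)) ≡⟨ S-sum r p v (λ x y → indicator x y) ⟩
      sum (λ x → S r p v (indicator x)) ≤⟨ sum-mono (λ x → walkCount≤1 t gg r p v x rt) ⟩
      sum {n} (λ _ → 1) ≡⟨ sum-const {n} 1 ⟩
      n * 1 ≡⟨ *-identityʳ n ⟩
      n ∎
      where open ≤-Reasoning

  total-S : ∀ m f → sum (λ u → S m nothing u f) ≤ d ^ m * sum f
  total-S zero f = ≤-reflexive (sym (+-identityʳ _))
  total-S (suc m) f = begin
    sum (λ u → sum (λ w → select (A u w) (S m (just u) w f))) ≤⟨ sum-mono (λ u → sum-mono (λ w → select-mono (A u w) (S-relax m (just u) w f))) ⟩
    sum (λ u → sum (λ w → select (A u w) (S m nothing w f))) ≡⟨ ∑-comm {n} {n} (λ u w → select (A u w) (S m nothing w f)) ⟩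
    sum (λ w → sum (λ u → select (A u w) (S m nothing w f)))
      ≡⟨ sum-cong-≗ (λ w → trans (sum-cong-≗ (λ u → cong (λ b → select b (S m nothing w f)) (Graph.sym G u w))) (neighbourSum w _)) ⟩
    sum (λ w → d * S m nothing w f) ≡⟨ sum-* {n} d _ ⟩
    d * sum (λ w → S m nothing w f) ≤⟨ *-monoʳ-≤ d (total-S m f) ⟩
    d * (d ^ m * sum f) ≡⟨ sym (*-assoc d (d ^ m) _) ⟩
    d ^ suc m * sum f ∎
    where open ≤-Reasoning

  module CopWalks {k : ℕ} where
    copCount : (Fin k → Fin n) → Fin n → ℕ
    copCount c y = sum (λ i → indicator (c i) y)

    N : ℕ → Fin n → (Fin k → Fin n) → ℕ
    N m u c = S m nothing u (copCount c)

    N-split : ∀ m u c → N m u c ≡ sum (λ i → S m nothing u (indicator (c i)))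
    N-split m u c = S-sum m nothing u (λ i y → indicator (c i) y)

    neighbour≤S1 : ∀ y x → select (A y x) 1 ≤ S 1 nothing y (indicator x)
    neighbour≤S1 y x = ≤-trans (≤-reflexive (cong (select (A y x)) (sym (cong (λ b → select b 1) (eqᵇ-refl x))))) (term≤sum (λ w → select (A y w) (indicator x w)) x)

    moved-indicator : ∀ x x' → (x' ≡ x ⊎ Adj G x x') → ∀ y → indicator x' y ≤ indicator x y + S 1 nothing y (indicator x)
    moved-indicator x .x (inj₁ refl) y = m≤m+n _ _
    moved-indicator x x' (inj₂ a) y with eqᵇ x' y in e
    ... | false = z≤n
    ... | true with eqᵇ⇒≡ x' y e
    ... | refl = ≤-trans (≤-reflexive (cong (λ b → select b 1) (sym (trans (Graph.sym G x' x) a)))) (≤-trans (neighbour≤S1 x' x) (m≤n+m _ _))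

    N-after-move : ∀ m u (c c' : Fin k → Fin n) → (∀ i → c' i ≡ c i ⊎ Adj G (c i) (c' i)) →
              N m u c' ≤ N m u c + Concatenation.P (copCount c) m 1 u
    N-after-move m u c c' st = begin
      N m u c' ≡⟨ N-split m u c' ⟩
      sum (λ i → S m nothing u (indicator (c' i)))
        ≤⟨ sum-mono (λ i → ≤-trans (S-mono m nothing u (moved-indicator (c i) (c' i) (st i))) (≤-reflexive (S-+ m nothing u _ _))) ⟩
      sum (λ i → S m nothing u (indicator (c i)) + S m nothing u (λ y → S 1 nothing y (indicator (c i))))
        ≡⟨ ∑-distrib-+ {k} (λ i → S m nothing u (indicator (c i))) (λ i → S m nothing u (λ y → S 1 nothing y (indicator (c i)))) ⟩
      sum (λ i → S m nothing u (indicator (c i))) + sum (λ i → S m nothing u (λ y → S 1 nothing y (indicator (c i))))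
        ≡⟨ cong₂ _+_ (sym (N-split m u c)) (sym (S-sum m nothing u (λ i y → S 1 nothing y (indicator (c i))))) ⟩
      N m u c + S m nothing u (λ y → sum (λ i → S 1 nothing y (indicator (c i))))
        ≡⟨ cong (N m u c +_) (S-cong m nothing u (λ y → sym (S-sum 1 nothing y (λ i z → indicator (c i) z)))) ⟩
      N m u c + Concatenation.P (copCount c) m 1 u ∎
      where open ≤-Reasoning

module Descending {n : ℕ} (G : Graph n) (d : ℕ) (reg : Regular G d) (t k : ℕ) where
  open WalkSums G
  open Regular-d d reg
  open UniqueWalks G
  open Counting G d reg
  open CopWalks {k}
  open Game G t k using (RobStep; stay; go; Occupied)

  copCount0⇒free : ∀ (c : Fin k → Fin n) w → copCount c w ≡ 0 → ¬ Occupied c w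
  copCount0⇒free c w e (i , refl) with ≤-trans (≤-reflexive (sym (cong (λ b → select b 1) (eqᵇ-refl (c i))))) (term≤sum (λ j → indicator (c j) (c i)) i)
  ... | q rewrite e = case q of λ ()

  -- For a target function g and weight H: W r p u charges each cop met after
  -- i steps with d^(r-i), which bounds the number of walks continuing through
  -- it, and F = S g + H W (F-eq).  If F r p u < H · #walks, then some walk of
  -- length r meets no cop and ends where g < H.
  module Descent (c : Fin k → Fin n) (H : ℕ) (g : Fin n → ℕ) where
    F : ℕ → Maybe (Fin n) → Fin n → ℕ
    F zero p u = g u
    F (suc r) p u = sum (λ w → select (allowed p u w) (H * (copCount c w * d ^ r) + F r (just u) w))

    W : ℕ → Maybe (Fin n) → Fin n → ℕ
    W zero p u = 0
    W (suc r) p u = sum (λ w → select (allowed p u w) (copCount c w * d ^ r + W r (just u) w))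

    F-eq : ∀ r p u → F r p u ≡ S r p u g + H * W r p u
    F-eq zero p u = sym (trans (cong (g u +_) (*-zeroʳ H)) (+-identityʳ _))
    F-eq (suc r) p u = begin
      sum (λ w → select (allowed p u w) (H * (copCount c w * d ^ r) + F r (just u) w))
        ≡⟨ sum-cong-≗ (λ w → cong (select (allowed p u w)) (trans (cong (H * (copCount c w * d ^ r) +_) (F-eq r (just u) w)) (arith H _ _ _))) ⟩
      sum (λ w → select (allowed p u w) (S r (just u) w g + H * (copCount c w * d ^ r + W r (just u) w)))
        ≡⟨ sum-cong-≗ (λ w → trans (select-+ (allowed p u w) _ _) (cong (select (allowed p u w) (S r (just u) w g) +_) (select-* (allowed p u w) H _))) ⟩
      sum (λ w → select (allowed p u w) (S r (just u) w g) + H * select (allowed p u w) (copCount c w * d ^ r + W r (just u) w))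
        ≡⟨ ∑-distrib-+ {n} _ _ ⟩
      S (suc r) p u g + sum (λ w → H * select (allowed p u w) (copCount c w * d ^ r + W r (just u) w)) ≡⟨ cong (S (suc r) p u g +_) (sum-* {n} H _) ⟩
      S (suc r) p u g + H * W (suc r) p u ∎
      where
      open ≡-Reasoning
      arith : ∀ H x y z → H * x + (y + H * z) ≡ y + H * (x + z)
      arith = solve-∀

    -- choose, by pigeonhole, a first step on which F is below average, and recurse
    descend : ∀ r p u → copCount c u ≡ 0 → F r p u < H * S r p u (λ _ → 1) →
              ∃[ u' ] (RobStep c r u u' × g u' < H × copCount c u' ≡ 0)
    descend zero p u z lt = u , stay , subst (g u <_) (*-identityʳ H) lt , z
    descend (suc r) p u z lt with sum-pigeonhole _ (λ w → select (allowed p u w) (H * S r (just u) w (λ _ → 1)))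
                                     (subst (F (suc r) p u <_) (trans (cong (H *_) refl) (sym (trans (sum-cong-≗ (λ w → select-* (allowed p u w) H _)) (sum-* {n} H _)))) lt)
    ... | w , q with allowed p u w in okw
    ... | false = ⊥-elim (<-irrefl refl q)
    ... | true with copCount c w in ccw
    ... | suc x = ⊥-elim (<-irrefl refl (≤-trans q bound))
      where
      bound : H * S r (just u) w (λ _ → 1) ≤ H * (suc x * d ^ r) + F r (just u) w
      bound = ≤-trans (*-monoʳ-≤ H (≤-trans (S-upper r (just u) w 1) (≤-trans (≤-reflexive (*-identityʳ _)) (m≤m+n (d ^ r) (x * d ^ r))))) (m≤m+n _ _)
    ... | zero with descend r (just u) w ccw (≤-<-trans (m≤n+m _ (H * 0)) q)
    ... | u' , rs , gl , z' = u' , go (allowed⇒adj p u w okw) (copCount0⇒free c w ccw) rs , gl , z'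

    select-sumTo : ∀ b r (h : ℕ → ℕ) → select b (sumTo r h) ≡ sumTo r (λ i → select b (h i))
    select-sumTo true r h = refl
    select-sumTo false r h = sym (trans (sumTo-cong r (λ _ _ → refl)) (trans (sumTo-const r 0) (*-zeroʳ r)))

    W-eq : ∀ r p u → W r p u ≡ sumTo r (λ i → d ^ (r ∸ suc i) * S (suc i) p u (copCount c))
    W-eq zero p u = refl
    W-eq (suc r) p u = begin
      sum (λ w → select (allowed p u w) (copCount c w * d ^ r + W r (just u) w)) ≡⟨ sum-cong-≗ (λ w → select-+ (allowed p u w) _ _) ⟩
      sum (λ w → select (allowed p u w) (copCount c w * d ^ r) + select (allowed p u w) (W r (just u) w)) ≡⟨ ∑-distrib-+ {n} _ _ ⟩
      sum (λ w → select (allowed p u w) (copCount c w * d ^ r)) + sum (λ w → select (allowed p u w) (W r (just u) w)) ≡⟨ cong₂ _+_ e1 e2 ⟩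
      d ^ r * S 1 p u (copCount c) + sumTo r (λ i → d ^ (r ∸ suc i) * S (suc (suc i)) p u (copCount c))
        ≡⟨ sym (sumTo-shift r (λ i → d ^ (suc r ∸ suc i) * S (suc i) p u (copCount c))) ⟩
      sumTo (suc r) (λ i → d ^ (suc r ∸ suc i) * S (suc i) p u (copCount c)) ∎
      where
      open ≡-Reasoning
      e1 : sum (λ w → select (allowed p u w) (copCount c w * d ^ r)) ≡ d ^ r * S 1 p u (copCount c)
      e1 = trans (sum-cong-≗ (λ w → trans (cong (select (allowed p u w)) (*-comm (copCount c w) (d ^ r))) (select-* (allowed p u w) (d ^ r) (copCount c w)))) (sum-* {n} (d ^ r) _)
      e2 : sum (λ w → select (allowed p u w) (W r (just u) w)) ≡ sumTo r (λ i → d ^ (r ∸ suc i) * S (suc (suc i)) p u (copCount c))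
      e2 = begin
        sum (λ w → select (allowed p u w) (W r (just u) w))
          ≡⟨ sum-cong-≗ (λ w → trans (cong (select (allowed p u w)) (W-eq r (just u) w)) (select-sumTo (allowed p u w) r _)) ⟩
        sum (λ w → sumTo r (λ i → select (allowed p u w) (d ^ (r ∸ suc i) * S (suc i) (just u) w (copCount c))))
          ≡⟨ sum-sumTo r (λ w i → select (allowed p u w) (d ^ (r ∸ suc i) * S (suc i) (just u) w (copCount c))) ⟩
        sumTo r (λ i → sum (λ w → select (allowed p u w) (d ^ (r ∸ suc i) * S (suc i) (just u) w (copCount c))))
          ≡⟨ sumTo-cong r (λ i _ → trans (sum-cong-≗ (λ w → select-* (allowed p u w) (d ^ (r ∸ suc i)) (S (suc i) (just u) w (copCount c)))) (sum-* {n} (d ^ (r ∸ suc i)) (λ w → select (allowed p u w) (S (suc i) (just u) w (copCount c))))) ⟩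
        sumTo r (λ i → d ^ (r ∸ suc i) * S (suc (suc i)) p u (copCount c)) ∎

-- The potential of the robber's position and the robber's strategy.  The
-- strategy is parametrised by the key inequality, which is proved later.
module Potential {n : ℕ} (G : Graph n) (d : ℕ) (reg : Regular G d) (t k : ℕ) (q : ℕ) (Λ : ℕ) where
  open WalkSums G
  open Regular-d d reg
  open UniqueWalks G
  open Counting G d reg
  open CopWalks {k}
  open Descending G d reg t k
  open Game G t k

  H : ℕ
  H = q ^ t

  -- Σ_{2 ≤ j ≤ t} q^(t+1-j) N_j, the cops at distance 2, …, t
  E : (Fin k → Fin n) → Fin n → ℕ
  E c u = sumTo (t ∸ 1) (λ i → q ^ (t ∸ suc i) * N (suc (suc i)) u c)

  g : (Fin k → Fin n) → Fin n → ℕ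
  g c u = H * (N 0 u c + N 1 u c) + Λ * E c u

  Safe : Fin n → (Fin k → Fin n) → Set
  Safe u c = g c u < H

  safe⇒noNearCop : ∀ u c → Safe u c → N 0 u c + N 1 u c ≡ 0
  safe⇒noNearCop u c safe = n<1⇒n≡0 (*-cancelˡ-< H (N 0 u c + N 1 u c) 1
    (≤-<-trans (m≤m+n _ (Λ * E c u)) (subst (g c u <_) (sym (*-identityʳ H)) safe)))

  safe⇒copFree : ∀ u c c' → Safe u c → CopStep c c' → copCount c' u ≡ 0
  safe⇒copFree u c c' safe moved = n≤0⇒n≡0 (≤-trans (N-after-move 0 u c c' moved) (≤-reflexive (safe⇒noNearCop u c safe)))

  module Strategy (keyIneq : ∀ u c c' → Safe u c → CopStep c c' →
                 S t nothing u (g c') + H * Descent.W c' H (g c') t nothing u < H * q ^ t)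
              (dq : d ≡ suc q) where
    open LowerBounds q dq

    safeMove : ∀ u c c' → Safe u c → CopStep c c' → ∃[ u' ] (RobStep c' t u u' × Safe u' c')
    safeMove u c c' safe moved with Descent.descend c' H (g c') t nothing u (safe⇒copFree u c c' safe moved) below
      where
      below : Descent.F c' H (g c') t nothing u < H * S t nothing u (λ _ → 1)
      below = ≤-trans (s≤s (≤-reflexive (Descent.F-eq c' H (g c') t nothing u)))
                (≤-trans (keyIneq u c c' safe moved) (*-monoʳ-≤ H (≤-trans (≤-reflexive (sym (*-identityʳ _))) (S-lower t nothing u 1))))
    ... | u' , walk , safe' , _ = u' , walk , safe'

    safe⇒¬copWin : ∀ c u → Safe u c → CopWin c u → ⊥
    safe⇒¬copWin c u safe (caught occ) = copCount0⇒free c u (m+n≡0⇒m≡0 (N 0 u c) (safe⇒noNearCop u c safe)) occ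
    safe⇒¬copWin c u safe (move c' moved (inj₁ occ)) = copCount0⇒free c' u (safe⇒copFree u c c' safe moved) occ
    safe⇒¬copWin c u safe (move c' moved (inj₂ next)) with safeMove u c c' safe moved
    ... | u' , walk , safe' = safe⇒¬copWin c' u' safe' (next u' walk)

    robberWins : (∀ c → ∃[ u ] Safe u c) → ¬ CopsWin G t k
    robberWins safeStart (c , win) with safeStart c
    ... | u , safe = safe⇒¬copWin c u safe (win u)

pow-mono : ∀ q {a b} → 1 ≤ q → a ≤ b → q ^ a ≤ q ^ b
pow-mono q q≥1 = ^-monoʳ-≤ q {{>-nonZero q≥1}}

1+q≤2q : ∀ {q} → 1 ≤ q → suc q ≤ 2 * q
1+q≤2q {q} q≥1 = ≤-trans (+-monoˡ-≤ q q≥1) (≤-reflexive (cong (q +_) (sym (+-identityʳ q))))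

pow≤2^*pow : ∀ d q a → d ≤ 2 * q → d ^ a ≤ 2 ^ a * q ^ a
pow≤2^*pow d q zero h = s≤s z≤n
pow≤2^*pow d q (suc a) h = ≤-trans (*-mono-≤ h (pow≤2^*pow d q a h)) (≤-reflexive (interchange′ 2 q (2 ^ a) (q ^ a)))
  where
  interchange′ : ∀ x y z w → x * y * (z * w) ≡ x * z * (y * w)
  interchange′ = solve-∀

4^≡2^ : ∀ t → 4 ^ t ≡ 2 ^ (t + t)
4^≡2^ zero = refl
4^≡2^ (suc t) = trans (cong (4 *_) (4^≡2^ t)) (trans (*-assoc 2 2 (2 ^ (t + t))) (cong (λ z → 2 ^ suc z) (sym (+-suc t t))))

-- index bookkeeping for the distances 2, …, t (indexed by i < t - 1)
suc<∸1 : ∀ a t → a < t ∸ 1 → suc a < t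
suc<∸1 a (suc t) h = s≤s h

<∸1 : ∀ i t → suc (suc i) ≤ t → i < t ∸ 1
<∸1 i (suc t) (s≤s h) = h

-- The constants: C1 t bounds the cops near the robber after the cops' move,
-- K0 t = (t+2)² exceeds the number of terms in the key inequality, and the
-- weight Λ(t) = degreeThreshold t is also the degree above which the
-- escape lemma applies.
C1 : ℕ → ℕ
C1 t = 1 + t * 4 ^ t

K0 : ℕ → ℕ
K0 t = (t + 2) * (t + 2)

degreeThreshold : ℕ → ℕ
degreeThreshold t = K0 t * (4 ^ t * C1 t)

posK0 : ∀ t → 1 ≤ K0 t
posK0 t = *-mono-≤ (≤-trans (s≤s z≤n) (m≤n+m 2 t)) (≤-trans (s≤s z≤n) (m≤n+m 2 t))

degreeThreshold-pos : ∀ t → 1 ≤ degreeThreshold t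
degreeThreshold-pos t = *-mono-≤ (posK0 t) (*-mono-≤ (m^n>0 4 t) (s≤s z≤n))

2^≤4^ : ∀ t a → a ≤ t + t → 2 ^ a ≤ 4 ^ t
2^≤4^ t a h = ≤-trans (pow-mono 2 (s≤s z≤n) h) (≤-reflexive (sym (4^≡2^ t)))

-- Here b m stands for N m u c' (the
-- walks of length m from the robber's vertex u to the cops after their move)
-- and T for the reduced concatenation counts of Concatenation, which are
-- values of b (Tval).  The two hypotheses on b are the facts about the cops
-- that the proof uses: near u they are few, weighted by Λ (after-near, from
-- safety before the move), and any vertex is reached by at most d^(m-t-1)
-- walks of length m (after-far, from the girth).  The sum Y bounds
-- S t u Φ + q^t W; it consists of fewer than K0 t = (t+2)² terms, each at
-- most Q / K0 t where Q = q^(2t), whence Y < Q.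
module KeyInequality (t q d k Λ : ℕ) (q1 : 1 ≤ q) (d2q : d ≤ 2 * q) (b : ℕ → ℕ) (T : ℕ → ℕ → ℕ)
  (Tval : ∀ m s → T m s ≡ 0 ⊎ ∃[ m' ] (m' + (s + s) ≡ m × T m s ≡ b m'))
  (after-near : ∀ m → suc m ≤ t → Λ * b m ≤ C1 t * q ^ m)
  (after-far : ∀ m → b m ≤ k * d ^ (m ∸ suc t))
  (hΛ : degreeThreshold t ≤ Λ)
  (hq : degreeThreshold t ≤ q)
  (hk : K0 t * (Λ * (4 ^ t * k)) ≤ q ^ t) where

  open ≤-Reasoning

  Q : ℕ
  Q = q ^ t * q ^ t

  Q-pos : 1 ≤ Q
  Q-pos = *-mono-≤ (pow-mono q {0} {t} q1 z≤n) (pow-mono q {0} {t} q1 z≤n)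

  q^2t≡Q : q ^ (t + t) ≡ Q
  q^2t≡Q = ^-distribˡ-+-* q t t

  Λ-pos : 1 ≤ Λ
  Λ-pos = ≤-trans (degreeThreshold-pos t) hΛ

  -- Three ways to see that a single term τ satisfies K0 t · τ ≤ Q, according
  -- to which hypothesis pays for it: few cops (hk), the weight Λ (hΛ), or the
  -- large degree (hq).
  term≤Q-fewCops : ∀ c e → c ≤ Λ * 4 ^ t → e ≤ t → K0 t * (c * k * q ^ e) ≤ Q
  term≤Q-fewCops c e hc he = begin
    K0 t * (c * k * q ^ e)            ≡⟨ regroup (K0 t) c k (q ^ e) ⟩
    K0 t * (c * k) * q ^ e
      ≤⟨ *-mono-≤ (*-monoʳ-≤ (K0 t) (≤-trans (*-monoˡ-≤ k hc) (≤-reflexive (*-assoc Λ (4 ^ t) k)))) (pow-mono q q1 he) ⟩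
    K0 t * (Λ * (4 ^ t * k)) * q ^ t  ≤⟨ *-monoˡ-≤ (q ^ t) hk ⟩
    Q                                 ∎
    where
    regroup : ∀ a b c d → a * (b * c * d) ≡ a * (b * c) * d
    regroup = solve-∀

  term≤Q-weighted : ∀ τ e → Λ * τ ≤ (4 ^ t * C1 t) * q ^ e → e ≤ t + t → K0 t * τ ≤ Q
  term≤Q-weighted τ e h he = *-cancelˡ-≤ Λ {{>-nonZero Λ-pos}} (begin
    Λ * (K0 t * τ)                   ≡⟨ swap-factors Λ (K0 t) τ ⟩
    K0 t * (Λ * τ)                   ≤⟨ *-monoʳ-≤ (K0 t) h ⟩
    K0 t * ((4 ^ t * C1 t) * q ^ e)  ≡⟨ *-assoc (K0 t) _ _ ⟨
    K0 t * (4 ^ t * C1 t) * q ^ e    ≤⟨ *-mono-≤ hΛ (pow-mono q q1 he) ⟩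
    Λ * q ^ (t + t)                  ≡⟨ cong (Λ *_) q^2t≡Q ⟩
    Λ * Q                            ∎)
    where
    swap-factors : ∀ a b c → a * (b * c) ≡ b * (a * c)
    swap-factors = solve-∀

  term≤Q-largeDegree : ∀ τ e → τ ≤ (4 ^ t * C1 t) * q ^ e → suc e ≤ t + t → K0 t * τ ≤ Q
  term≤Q-largeDegree τ e h he = begin
    K0 t * τ                         ≤⟨ *-monoʳ-≤ (K0 t) h ⟩
    K0 t * ((4 ^ t * C1 t) * q ^ e)  ≡⟨ *-assoc (K0 t) _ _ ⟨
    K0 t * (4 ^ t * C1 t) * q ^ e    ≤⟨ *-monoˡ-≤ (q ^ e) hq ⟩
    q * q ^ e                        ≤⟨ pow-mono q q1 he ⟩
    q ^ (t + t)                      ≡⟨ q^2t≡Q ⟩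
    Q                                ∎

  vanishing-term : ∀ x y z w → w ≡ 0 → K0 t * (x * (y * (z * w))) ≤ Q
  vanishing-term x y z w e rewrite e | *-zeroʳ z | *-zeroʳ y | *-zeroʳ x | *-zeroʳ (K0 t) = z≤n

  -- The hit terms q^t d^(t-1-i) b (i+1), i < t, coming from W.
  hitTerm-bound : ∀ i → i < t → K0 t * (q ^ t * (d ^ (t ∸ suc i) * b (suc i))) ≤ Q
  hitTerm-bound i it with suc (suc i) ≤? t
  ... | yes h = term≤Q-weighted _ (t + t) bound ≤-refl
    where
    e = t ∸ suc i
    ee : e + suc i ≡ t
    ee = m∸n+n≡m it
    qq : q ^ e * q ^ i * q ≡ q ^ t
    qq = trans (*-assoc (q ^ e) (q ^ i) q) (trans (cong (q ^ e *_) (*-comm (q ^ i) q)) (trans (sym (^-distribˡ-+-* q e (suc i))) (cong (q ^_) ee)))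
    regroup : ∀ L a x y → L * (a * (x * y)) ≡ a * (x * (L * y))
    regroup = solve-∀
    regroup′ : ∀ a x y c z w → a * ((x * y) * (c * (z * w))) ≡ (x * c) * (a * ((y * w) * z))
    regroup′ = solve-∀
    bound : Λ * (q ^ t * (d ^ e * b (suc i))) ≤ (4 ^ t * C1 t) * q ^ (t + t)
    bound = begin
      Λ * (q ^ t * (d ^ e * b (suc i)))                  ≡⟨ regroup Λ (q ^ t) (d ^ e) (b (suc i)) ⟩
      q ^ t * (d ^ e * (Λ * b (suc i)))                  ≤⟨ *-monoʳ-≤ (q ^ t) (*-mono-≤ (pow≤2^*pow d q e d2q) (after-near (suc i) h)) ⟩
      q ^ t * ((2 ^ e * q ^ e) * (C1 t * (q * q ^ i)))   ≡⟨ regroup′ (q ^ t) (2 ^ e) (q ^ e) (C1 t) q (q ^ i) ⟩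
      (2 ^ e * C1 t) * (q ^ t * ((q ^ e * q ^ i) * q))   ≡⟨ cong (λ z → (2 ^ e * C1 t) * (q ^ t * z)) qq ⟩
      (2 ^ e * C1 t) * (q ^ t * q ^ t)                   ≡⟨ cong ((2 ^ e * C1 t) *_) (sym q^2t≡Q) ⟩
      (2 ^ e * C1 t) * q ^ (t + t)
        ≤⟨ *-monoˡ-≤ (q ^ (t + t)) (*-monoˡ-≤ (C1 t) (2^≤4^ t e (≤-trans (m∸n≤m t (suc i)) (m≤m+n t t)))) ⟩
      (4 ^ t * C1 t) * q ^ (t + t)                       ∎
  ... | no h = ≤-trans (*-monoʳ-≤ (K0 t) bound) (term≤Q-fewCops 1 t (*-mono-≤ Λ-pos (m^n>0 4 t)) ≤-refl)
    where
    st : suc i ≡ t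
    st = ≤-antisym it (≮⇒≥ h)
    regroup : ∀ x y → x * (1 * (y * 1)) ≡ 1 * y * x
    regroup = solve-∀
    bound : q ^ t * (d ^ (t ∸ suc i) * b (suc i)) ≤ 1 * k * q ^ t
    bound = begin
      q ^ t * (d ^ (t ∸ suc i) * b (suc i))  ≡⟨ cong (λ z → q ^ t * (d ^ (t ∸ z) * b z)) st ⟩
      q ^ t * (d ^ (t ∸ t) * b t)            ≡⟨ cong (λ z → q ^ t * (d ^ z * b t)) (n∸n≡0 t) ⟩
      q ^ t * (1 * b t)                      ≤⟨ *-monoʳ-≤ (q ^ t) (*-monoʳ-≤ 1 (after-far t)) ⟩
      q ^ t * (1 * (k * d ^ (t ∸ suc t)))    ≡⟨ cong (λ z → q ^ t * (1 * (k * d ^ z))) (m≤n⇒m∸n≡0 (n≤1+n t)) ⟩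
      q ^ t * (1 * (k * 1))                  ≡⟨ regroup (q ^ t) k ⟩
      1 * k * q ^ t                          ∎

  -- The close terms q^t 2^t d^s T (t+j) s, j ≤ 1, coming from q^t (N₀ + N₁).
  closeTerm-bound : ∀ j → j ≤ 1 → ∀ s → s ≤ t → K0 t * (q ^ t * (2 ^ t * (d ^ s * T (t + j) s))) ≤ Q
  closeTerm-bound j j1 s st with Tval (t + j) s
  ... | inj₁ e = vanishing-term (q ^ t) (2 ^ t) (d ^ s) _ e
  closeTerm-bound j j1 zero st | inj₂ (m' , em , eT) =
    ≤-trans (*-monoʳ-≤ (K0 t) bound) (term≤Q-fewCops (2 ^ t) t coeff ≤-refl)
    where
    coeff : 2 ^ t ≤ Λ * 4 ^ t
    coeff = ≤-trans (≤-trans (≤-reflexive (sym (*-identityˡ _))) (*-monoˡ-≤ (2 ^ t) Λ-pos)) (*-monoʳ-≤ Λ (2^≤4^ t t (m≤m+n t t)))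
    m'≤ : m' ≤ suc t
    m'≤ = ≤-trans (≤-reflexive (trans (sym (+-identityʳ m')) em)) (≤-trans (+-monoʳ-≤ t j1) (≤-reflexive (+-comm t 1)))
    regroup : ∀ x y z → x * (y * (1 * (z * 1))) ≡ y * z * x
    regroup = solve-∀
    bound : q ^ t * (2 ^ t * (d ^ 0 * T (t + j) 0)) ≤ 2 ^ t * k * q ^ t
    bound = begin
      q ^ t * (2 ^ t * (1 * T (t + j) 0))             ≡⟨ cong (λ z → q ^ t * (2 ^ t * (1 * z))) eT ⟩
      q ^ t * (2 ^ t * (1 * b m'))                    ≤⟨ *-monoʳ-≤ (q ^ t) (*-monoʳ-≤ (2 ^ t) (*-monoʳ-≤ 1 (after-far m'))) ⟩
      q ^ t * (2 ^ t * (1 * (k * d ^ (m' ∸ suc t))))  ≡⟨ cong (λ z → q ^ t * (2 ^ t * (1 * (k * d ^ z)))) (m≤n⇒m∸n≡0 m'≤) ⟩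
      q ^ t * (2 ^ t * (1 * (k * 1)))                 ≡⟨ regroup (q ^ t) (2 ^ t) k ⟩
      2 ^ t * k * q ^ t                               ∎
  closeTerm-bound j j1 (suc s') st | inj₂ (m' , em , eT) = term≤Q-weighted _ (t + t) bound ≤-refl
    where
    s = suc s'
    ms : m' + s ≤ t
    ms = +-cancelʳ-≤ s (m' + s) t (begin
      m' + s + s    ≡⟨ +-assoc m' s s ⟩
      m' + (s + s)  ≡⟨ em ⟩
      t + j         ≤⟨ +-monoʳ-≤ t (≤-trans j1 (s≤s z≤n)) ⟩
      t + s         ∎)
    m1 : suc m' ≤ t
    m1 = ≤-trans (≤-trans (≤-reflexive (+-comm 1 m')) (+-monoʳ-≤ m' (s≤s z≤n))) ms
    regroup : ∀ L a c x y → L * (a * (c * (x * y))) ≡ a * (c * (x * (L * y)))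
    regroup = solve-∀
    regroup′ : ∀ a c x y C z → a * (c * ((x * y) * (C * z))) ≡ (c * x * C) * (a * (y * z))
    regroup′ = solve-∀
    bound : Λ * (q ^ t * (2 ^ t * (d ^ s * T (t + j) s))) ≤ (4 ^ t * C1 t) * q ^ (t + t)
    bound = begin
      Λ * (q ^ t * (2 ^ t * (d ^ s * T (t + j) s)))          ≡⟨ cong (λ z → Λ * (q ^ t * (2 ^ t * (d ^ s * z)))) eT ⟩
      Λ * (q ^ t * (2 ^ t * (d ^ s * b m')))                 ≡⟨ regroup Λ (q ^ t) (2 ^ t) (d ^ s) (b m') ⟩
      q ^ t * (2 ^ t * (d ^ s * (Λ * b m')))
        ≤⟨ *-monoʳ-≤ (q ^ t) (*-monoʳ-≤ (2 ^ t) (*-mono-≤ (pow≤2^*pow d q s d2q) (after-near m' m1))) ⟩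
      q ^ t * (2 ^ t * ((2 ^ s * q ^ s) * (C1 t * q ^ m')))  ≡⟨ regroup′ (q ^ t) (2 ^ t) (2 ^ s) (q ^ s) (C1 t) (q ^ m') ⟩
      (2 ^ t * 2 ^ s * C1 t) * (q ^ t * (q ^ s * q ^ m'))
        ≤⟨ *-mono-≤ (*-monoˡ-≤ (C1 t) (≤-trans (≤-reflexive (sym (^-distribˡ-+-* 2 t s))) (2^≤4^ t (t + s) (+-monoʳ-≤ t st)))) (*-monoʳ-≤ (q ^ t) (≤-trans (≤-reflexive (sym (^-distribˡ-+-* q s m'))) (pow-mono q q1 (≤-trans (≤-reflexive (+-comm s m')) ms)))) ⟩
      (4 ^ t * C1 t) * (q ^ t * q ^ t)                       ≡⟨ cong ((4 ^ t * C1 t) *_) (sym q^2t≡Q) ⟩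
      (4 ^ t * C1 t) * q ^ (t + t)                           ∎

  -- The far terms Λ q^(t-1-i) 2^t d^s T (t+2+i) s, i < t-1, coming from Λ E,
  -- when the reduced walk has length m' with m' + 2s = t + 2 + i.
  module FarTerm (i : ℕ) (it : i < t ∸ 1) (s : ℕ) (st : s ≤ t) (m' : ℕ) (em : m' + (s + s) ≡ t + suc (suc i)) where
    e : ℕ
    e = t ∸ suc i
    it2 : suc (suc i) ≤ t
    it2 = suc<∸1 i t it
    ee : e + suc i ≡ t
    ee = m∸n+n≡m (≤-trans (n≤1+n _) it2)

    -- a short reduced walk (m' < t) is paid for by the weight Λ and q
    short : suc m' ≤ t → K0 t * (Λ * (q ^ e * (2 ^ t * (d ^ s * b m')))) ≤ Q
    short h = term≤Q-largeDegree _ x bound x1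
      where
      x = e + (s + m')
      s2 : 2 ≤ s
      s2 = ≮⇒≥ λ s<2 → <-irrefl refl (begin-strict
        t + suc (suc i)  ≡⟨ sym em ⟩
        m' + (s + s)     ≤⟨ +-monoʳ-≤ m' (+-mono-≤ (≤-pred s<2) (≤-pred s<2)) ⟩
        m' + 2           <⟨ +-monoˡ-< 2 h ⟩
        t + 2            ≤⟨ +-monoʳ-≤ t (s≤s (s≤s z≤n)) ⟩
        t + suc (suc i)  ∎)
      xs : x + s ≡ suc (t + t)
      xs = begin-equality
        e + (s + m') + s       ≡⟨ regroupₐ e s m' ⟩
        e + (m' + (s + s))     ≡⟨ cong (e +_) em ⟩
        e + (t + suc (suc i))  ≡⟨ regroupₐ′ e t i ⟩
        (e + suc i) + suc t    ≡⟨ cong (_+ suc t) ee ⟩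
        t + suc t              ≡⟨ +-suc t t ⟩
        suc (t + t)            ∎
        where
        regroupₐ : ∀ a b c → a + (b + c) + b ≡ a + (c + (b + b))
        regroupₐ = solve-∀
        regroupₐ′ : ∀ a b c → a + (b + suc (suc c)) ≡ (a + suc c) + suc b
        regroupₐ′ = solve-∀
      x1 : suc x ≤ t + t
      x1 = ≤-pred (≤-trans (≤-reflexive (sym (+-comm x 2))) (≤-trans (+-monoʳ-≤ x s2) (≤-reflexive xs)))
      regroup : ∀ L a c x y → L * (a * (c * (x * y))) ≡ a * (c * (x * (L * y)))
      regroup = solve-∀
      regroup′ : ∀ a c x y C z → a * (c * ((x * y) * (C * z))) ≡ (c * x * C) * (a * (y * z))
      regroup′ = solve-∀
      bound : Λ * (q ^ e * (2 ^ t * (d ^ s * b m'))) ≤ (4 ^ t * C1 t) * q ^ x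
      bound = begin
        Λ * (q ^ e * (2 ^ t * (d ^ s * b m')))                 ≡⟨ regroup Λ (q ^ e) (2 ^ t) (d ^ s) (b m') ⟩
        q ^ e * (2 ^ t * (d ^ s * (Λ * b m')))
          ≤⟨ *-monoʳ-≤ (q ^ e) (*-monoʳ-≤ (2 ^ t) (*-mono-≤ (pow≤2^*pow d q s d2q) (after-near m' h))) ⟩
        q ^ e * (2 ^ t * ((2 ^ s * q ^ s) * (C1 t * q ^ m')))  ≡⟨ regroup′ (q ^ e) (2 ^ t) (2 ^ s) (q ^ s) (C1 t) (q ^ m') ⟩
        (2 ^ t * 2 ^ s * C1 t) * (q ^ e * (q ^ s * q ^ m'))
          ≡⟨ cong₂ (λ a b → (a * C1 t) * b) (sym (^-distribˡ-+-* 2 t s)) (trans (cong (q ^ e *_) (sym (^-distribˡ-+-* q s m'))) (sym (^-distribˡ-+-* q e (s + m')))) ⟩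
        (2 ^ (t + s) * C1 t) * q ^ x                           ≤⟨ *-monoˡ-≤ (q ^ x) (*-monoˡ-≤ (C1 t) (2^≤4^ t (t + s) (+-monoʳ-≤ t st))) ⟩
        (4 ^ t * C1 t) * q ^ x                                 ∎

    long-length : ¬ suc m' ≤ t → s + (m' ∸ suc t) ≤ suc i
    long-length h with m≤n⇒m<n∨m≡n (≮⇒≥ h)
    ... | inj₂ mt = ≤-trans (≤-reflexive (trans (cong (s +_) (trans (cong (_∸ suc t) (sym mt)) (m≤n⇒m∸n≡0 (n≤1+n t)))) (+-identityʳ s))) sle
      where
      ss : s + s ≡ suc (suc i)
      ss = +-cancelˡ-≡ t _ _ (trans (cong (_+ (s + s)) mt) em)
      s1 : 1 ≤ s
      s1 = ≮⇒≥ λ s<1 → case trans (sym (cong₂ _+_ (n≤0⇒n≡0 (≤-pred s<1)) (n≤0⇒n≡0 (≤-pred s<1)))) ss of λ ()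
      sle : s ≤ suc i
      sle = ≤-pred (≤-trans (≤-reflexive (+-comm 1 s)) (≤-trans (+-monoʳ-≤ s s1) (≤-reflexive ss)))
    ... | inj₁ tm = ≤-trans (≤-reflexive (+-comm s r)) (≤-trans (+-monoʳ-≤ r (m≤m+n s s)) (≤-reflexive rss))
      where
      r = m' ∸ suc t
      rss : r + (s + s) ≡ suc i
      rss = suc-injective (+-cancelˡ-≡ t _ _ (begin-equality
        t + suc (r + (s + s))  ≡⟨ regroup t r (s + s) ⟩
        r + suc t + (s + s)    ≡⟨ cong (_+ (s + s)) (m∸n+n≡m tm) ⟩
        m' + (s + s)           ≡⟨ em ⟩
        t + suc (suc i)        ∎))
        where
        regroup : ∀ a b c → a + suc (b + c) ≡ b + suc a + c
        regroup = solve-∀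

    -- a long reduced walk (m' ≥ t) is paid for by the girth bound and few cops
    long : ¬ suc m' ≤ t → K0 t * (Λ * (q ^ e * (2 ^ t * (d ^ s * b m')))) ≤ Q
    long h = ≤-trans (*-monoʳ-≤ (K0 t) bound) (term≤Q-fewCops c x cb xb)
      where
      r = m' ∸ suc t
      sr : s + r ≤ suc i
      sr = long-length h
      x = e + (s + r)
      xb : x ≤ t
      xb = ≤-trans (+-monoʳ-≤ e sr) (≤-reflexive ee)
      c = Λ * (2 ^ t * (2 ^ s * 2 ^ r))
      cb : c ≤ Λ * 4 ^ t
      cb = *-monoʳ-≤ Λ (≤-trans (≤-reflexive (trans (cong (2 ^ t *_) (sym (^-distribˡ-+-* 2 s r))) (sym (^-distribˡ-+-* 2 t (s + r)))))
             (2^≤4^ t (t + (s + r)) (+-monoʳ-≤ t (≤-trans sr (≤-trans (n≤1+n _) it2)))))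
      regroup : ∀ L a c x y K z w → L * (a * (c * ((x * y) * (K * (z * w))))) ≡ L * (c * (x * z)) * K * (a * (y * w))
      regroup = solve-∀
      bound : Λ * (q ^ e * (2 ^ t * (d ^ s * b m'))) ≤ c * k * q ^ x
      bound = begin
        Λ * (q ^ e * (2 ^ t * (d ^ s * b m')))
          ≤⟨ *-monoʳ-≤ Λ (*-monoʳ-≤ (q ^ e) (*-monoʳ-≤ (2 ^ t) (*-mono-≤ (pow≤2^*pow d q s d2q) (≤-trans (after-far m') (*-monoʳ-≤ k (pow≤2^*pow d q r d2q)))))) ⟩
        Λ * (q ^ e * (2 ^ t * ((2 ^ s * q ^ s) * (k * (2 ^ r * q ^ r)))))  ≡⟨ regroup Λ (q ^ e) (2 ^ t) (2 ^ s) (q ^ s) k (2 ^ r) (q ^ r) ⟩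
        c * k * (q ^ e * (q ^ s * q ^ r))
          ≡⟨ cong (c * k *_) (trans (cong (q ^ e *_) (sym (^-distribˡ-+-* q s r))) (sym (^-distribˡ-+-* q e (s + r)))) ⟩
        c * k * q ^ x                                                      ∎

  farTerm-bound : ∀ i → i < t ∸ 1 → ∀ s → s ≤ t → K0 t * (Λ * (q ^ (t ∸ suc i) * (2 ^ t * (d ^ s * T (t + suc (suc i)) s)))) ≤ Q
  farTerm-bound i it s st with Tval (t + suc (suc i)) s
  ... | inj₁ e = vanishing-term Λ (q ^ (t ∸ suc i)) (2 ^ t) (d ^ s * _) (trans (cong (d ^ s *_) e) (*-zeroʳ (d ^ s)))
  ... | inj₂ (m' , em , eT) rewrite eT with suc m' ≤? t
  ...   | yes h = FarTerm.short i it s st m' em h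
  ...   | no h = FarTerm.long i it s st m' em h

  sumTo-scaled-bound : ∀ K c (f : ℕ → ℕ) B → (∀ i → i < K → K0 t * (c * f i) ≤ B) → K0 t * (c * sumTo K f) ≤ K * B
  sumTo-scaled-bound K c f B h = begin
    K0 t * (c * sumTo K f)            ≡⟨ cong (K0 t *_) (sym (sumTo-* K c f)) ⟩
    K0 t * sumTo K (λ i → c * f i)    ≡⟨ sym (sumTo-* K (K0 t) _) ⟩
    sumTo K (λ i → K0 t * (c * f i))  ≤⟨ sumTo-bound K _ B h ⟩
    K * B                             ∎

  closeTerms : ℕ → ℕ
  closeTerms j = q ^ t * (2 ^ t * sumTo (suc t) (λ s → d ^ s * T (t + j) s))

  farTerms : ℕ
  farTerms = Λ * sumTo (t ∸ 1) (λ i → q ^ (t ∸ suc i) * (2 ^ t * sumTo (suc t) (λ s → d ^ s * T (t + suc (suc i)) s)))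

  hitTerms : ℕ
  hitTerms = q ^ t * sumTo t (λ i → d ^ (t ∸ suc i) * b (suc i))

  Y : ℕ
  Y = (closeTerms 0 + closeTerms 1) + farTerms + hitTerms

  closeTerms-bound : ∀ j → j ≤ 1 → K0 t * closeTerms j ≤ suc t * Q
  closeTerms-bound j j1 = ≤-trans (≤-reflexive (cong (K0 t *_) (sym (*-assoc (q ^ t) (2 ^ t) _))))
    (sumTo-scaled-bound (suc t) (q ^ t * 2 ^ t) _ Q
      (λ s st → ≤-trans (≤-reflexive (cong (K0 t *_) (*-assoc (q ^ t) (2 ^ t) _))) (closeTerm-bound j j1 s (≤-pred st))))

  farTerms-bound : K0 t * farTerms ≤ (t ∸ 1) * (suc t * Q)
  farTerms-bound = sumTo-scaled-bound (t ∸ 1) Λ _ (suc t * Q) λ i it → begin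
    K0 t * (Λ * (q ^ (t ∸ suc i) * (2 ^ t * sumTo (suc t) (λ s → d ^ s * T (t + suc (suc i)) s))))
      ≡⟨ cong (K0 t *_) (regroup Λ (q ^ (t ∸ suc i)) (2 ^ t) _) ⟩
    K0 t * ((Λ * (q ^ (t ∸ suc i) * 2 ^ t)) * sumTo (suc t) (λ s → d ^ s * T (t + suc (suc i)) s))
      ≤⟨ sumTo-scaled-bound (suc t) (Λ * (q ^ (t ∸ suc i) * 2 ^ t)) (λ s → d ^ s * T (t + suc (suc i)) s) Q
           (λ s st → ≤-trans (≤-reflexive (cong (K0 t *_) (sym (regroup Λ (q ^ (t ∸ suc i)) (2 ^ t) (d ^ s * T (t + suc (suc i)) s)))))
                             (farTerm-bound i it s (≤-pred st))) ⟩
    suc t * Q ∎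
    where
    regroup : ∀ a b c d → a * (b * (c * d)) ≡ (a * (b * c)) * d
    regroup = solve-∀

  hitTerms-bound : K0 t * hitTerms ≤ t * Q
  hitTerms-bound = sumTo-scaled-bound t (q ^ t) _ Q hitTerm-bound

  termCount< : 2 * suc t + t * suc t + t < K0 t
  termCount< = ≤-trans (n≤1+n _) (≤-reflexive (count t))
    where
    count : ∀ t → suc (suc (2 * suc t + t * suc t + t)) ≡ (t + 2) * (t + 2)
    count = solve-∀

  Y<Q : Y < Q
  Y<Q = *-cancelˡ-< (K0 t) Y Q (begin-strict
    K0 t * Y
      ≡⟨ distribute (K0 t) (closeTerms 0) (closeTerms 1) farTerms hitTerms ⟩
    K0 t * closeTerms 0 + K0 t * closeTerms 1 + K0 t * farTerms + K0 t * hitTerms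
      ≤⟨ +-mono-≤ (+-mono-≤ (+-mono-≤ (closeTerms-bound 0 z≤n) (closeTerms-bound 1 ≤-refl)) farTerms-bound) hitTerms-bound ⟩
    suc t * Q + suc t * Q + (t ∸ 1) * (suc t * Q) + t * Q
      ≤⟨ +-monoˡ-≤ (t * Q) (+-monoʳ-≤ (suc t * Q + suc t * Q) (*-monoˡ-≤ (suc t * Q) (m∸n≤m t 1))) ⟩
    suc t * Q + suc t * Q + t * (suc t * Q) + t * Q
      ≡⟨ collect t Q ⟩
    (2 * suc t + t * suc t + t) * Q
      <⟨ *-monoˡ-< Q {{>-nonZero Q-pos}} termCount< ⟩
    K0 t * Q ∎)
    where
    distribute : ∀ K a b c e → K * ((a + b) + c + e) ≡ K * a + K * b + K * c + K * e
    distribute = solve-∀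
    collect : ∀ t Q → suc t * Q + suc t * Q + t * (suc t * Q) + t * Q ≡ (2 * suc t + t * suc t + t) * Q
    collect = solve-∀

module Escape {n : ℕ} (G : Graph n) (d : ℕ) (reg : Regular G d) (t : ℕ) (gg : GirthGreaterThan G (2 * t + 2))
            (k q : ℕ) (dq : d ≡ suc q) (q1 : 1 ≤ q)
            (hq : degreeThreshold t ≤ q)
            (hk : K0 t * (degreeThreshold t * (4 ^ t * k)) ≤ q ^ t) where

  Λ : ℕ
  Λ = degreeThreshold t

  open WalkSums G
  open Regular-d d reg
  open UniqueWalks G
  open Counting G d reg
  open HighGirth t gg
  open CopWalks {k}
  open Descending G d reg t k
  open Potential G d reg t k q Λ
  open Game G t k
  open LowerBounds q dq
  open ≤-Reasoning

  d2q : d ≤ 2 * q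
  d2q = subst (_≤ 2 * q) (sym dq) (1+q≤2q q1)

  module Before (u : Fin n) (c : Fin k → Fin n) (safe : Safe u c) where
    a : ℕ → ℕ
    a m = N m u c

    vanishes : ∀ {z} → z ≡ 0 → Λ * (q * z) ≡ 0
    vanishes refl = trans (cong (Λ *_) (*-zeroʳ q)) (*-zeroʳ Λ)

    before-bound : ∀ j → j ≤ t → Λ * (q * a j) ≤ q ^ j
    before-bound zero _ = ≤-trans (≤-reflexive (vanishes (m+n≡0⇒m≡0 (N 0 u c) (safe⇒noNearCop u c safe)))) z≤n
    before-bound (suc zero) _ = ≤-trans (≤-reflexive (vanishes (m+n≡0⇒n≡0 (N 0 u c) (safe⇒noNearCop u c safe)))) z≤n
    before-bound (suc (suc i)) jt = begin
      Λ * (q * a (suc (suc i)))  ≡⟨ swap-factors Λ q (a (suc (suc i))) ⟩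
      q * (Λ * a (suc (suc i)))  ≤⟨ *-monoʳ-≤ q (<⇒≤ lt) ⟩
      q * q ^ suc i              ∎
      where
      swap-factors : ∀ x y z → x * (y * z) ≡ y * (x * z)
      swap-factors = solve-∀
      e = t ∸ suc i
      ee : e + suc i ≡ t
      ee = m∸n+n≡m (≤-trans (n≤1+n _) jt)
      lt : Λ * a (suc (suc i)) < q ^ suc i
      lt = *-cancelˡ-< (q ^ e) _ _ (begin-strict
        q ^ e * (Λ * a (suc (suc i)))  ≡⟨ swap-factors (q ^ e) Λ _ ⟩
        Λ * (q ^ e * a (suc (suc i)))  ≤⟨ *-monoʳ-≤ Λ (term≤sumTo (t ∸ 1) (λ i → q ^ (t ∸ suc i) * N (suc (suc i)) u c) i (<∸1 i t jt)) ⟩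
        Λ * E c u                      ≤⟨ m≤n+m _ _ ⟩
        g c u                          <⟨ safe ⟩
        q ^ t                          ≡⟨ cong (q ^_) (sym ee) ⟩
        q ^ (e + suc i)                ≡⟨ ^-distribˡ-+-* q e (suc i) ⟩
        q ^ e * q ^ suc i              ∎)

  module After (u : Fin n) (c : Fin k → Fin n) (safe : Safe u c) (c' : Fin k → Fin n) (moved : CopStep c c') where
    open Before u c safe

    b : ℕ → ℕ
    b m = N m u c'

    reduced-bound : ∀ m → suc m ≤ t → ∀ s → s < suc m → Λ * (q * (d ^ s * Concatenation.T (copCount c) (m + 1) s u)) ≤ 2 ^ t * q ^ suc m
    reduced-bound m mt s sm with Concatenation.T-value (copCount c) (m + 1) s u
    ... | inj₁ e = ≤-trans (≤-reflexive (trans (cong (λ z → Λ * (q * z)) (trans (cong (d ^ s *_) e) (*-zeroʳ (d ^ s)))) (vanishes refl))) z≤n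
    ... | inj₂ (m' , em , eT) = begin
      Λ * (q * (d ^ s * Concatenation.T (copCount c) (m + 1) s u))  ≡⟨ cong (λ z → Λ * (q * (d ^ s * z))) eT ⟩
      Λ * (q * (d ^ s * a m'))                                      ≡⟨ regroup Λ q (d ^ s) (a m') ⟩
      d ^ s * (Λ * (q * a m'))                                      ≤⟨ *-mono-≤ (pow≤2^*pow d q s d2q) (before-bound m' m't) ⟩
      (2 ^ s * q ^ s) * q ^ m'
        ≡⟨ trans (*-assoc (2 ^ s) (q ^ s) (q ^ m')) (cong (2 ^ s *_) (sym (^-distribˡ-+-* q s m'))) ⟩
      2 ^ s * q ^ (s + m')
        ≤⟨ *-mono-≤ (pow-mono 2 (s≤s z≤n) (≤-trans (≤-pred sm) (≤-trans (n≤1+n m) mt))) (pow-mono q q1 sm') ⟩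
      2 ^ t * q ^ suc m                                             ∎
      where
      regroup : ∀ x y z w → x * (y * (z * w)) ≡ z * (x * (y * w))
      regroup = solve-∀
      em' : m' + (s + s) ≡ suc m
      em' = trans em (+-comm m 1)
      m't : m' ≤ t
      m't = ≤-trans (≤-trans (m≤m+n m' (s + s)) (≤-reflexive em')) mt
      sm' : s + m' ≤ suc m
      sm' = ≤-trans (≤-reflexive (+-comm s m')) (≤-trans (+-monoʳ-≤ m' (m≤n+m s s)) (≤-reflexive em'))

    after-near : ∀ m → suc m ≤ t → Λ * b m ≤ C1 t * q ^ m
    after-near m mt = *-cancelˡ-≤ q {{>-nonZero q1}} (begin
      q * (Λ * b m)
        ≡⟨ swap-factors q Λ (b m) ⟩
      Λ * (q * b m)
        ≤⟨ *-monoʳ-≤ Λ (*-monoʳ-≤ q (N-after-move m u c c' moved)) ⟩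
      Λ * (q * (a m + Concatenation.P (copCount c) m 1 u))
        ≡⟨ distribute Λ q (a m) _ ⟩
      Λ * (q * a m) + Λ * (q * Concatenation.P (copCount c) m 1 u)
        ≤⟨ +-mono-≤ (≤-trans (before-bound m (≤-trans (n≤1+n m) mt)) (pow-mono q q1 (n≤1+n m))) (*-monoʳ-≤ Λ (*-monoʳ-≤ q (Concatenation.concat-bound (copCount c) m 1 u))) ⟩
      q ^ suc m + Λ * (q * (2 ^ m * sumTo (suc m) reduced))
        ≡⟨ cong (q ^ suc m +_) (trans (regroup Λ q (2 ^ m) (sumTo (suc m) reduced)) (cong (2 ^ m *_) (trans (sym (sumTo-* (suc m) (Λ * q) reduced)) (sumTo-cong (suc m) (λ s _ → *-assoc Λ q (reduced s)))))) ⟩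
      q ^ suc m + 2 ^ m * sumTo (suc m) (λ s → Λ * (q * reduced s))
        ≤⟨ +-monoʳ-≤ (q ^ suc m) (*-monoʳ-≤ (2 ^ m) (sumTo-bound (suc m) _ _ (reduced-bound m mt))) ⟩
      q ^ suc m + 2 ^ m * (suc m * (2 ^ t * q ^ suc m))
        ≡⟨ cong (q ^ suc m +_) (regroup′ (2 ^ m) (suc m) (2 ^ t) (q ^ suc m)) ⟩
      q ^ suc m + (suc m * (2 ^ m * 2 ^ t)) * q ^ suc m
        ≤⟨ +-monoʳ-≤ (q ^ suc m) (*-monoˡ-≤ (q ^ suc m) (*-mono-≤ mt (≤-trans (≤-reflexive (sym (^-distribˡ-+-* 2 m t))) (2^≤4^ t (m + t) (+-monoˡ-≤ t (≤-trans (n≤1+n m) mt)))))) ⟩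
      q ^ suc m + (t * 4 ^ t) * q ^ suc m
        ≡⟨ collect (q ^ suc m) (t * 4 ^ t) ⟩
      C1 t * q ^ suc m
        ≡⟨ swap-factors (C1 t) q (q ^ m) ⟩
      q * (C1 t * q ^ m) ∎)
      where
      reduced : ℕ → ℕ
      reduced s = d ^ s * Concatenation.T (copCount c) (m + 1) s u
      swap-factors : ∀ x y z → x * (y * z) ≡ y * (x * z)
      swap-factors = solve-∀
      distribute : ∀ x y z w → x * (y * (z + w)) ≡ x * (y * z) + x * (y * w)
      distribute = solve-∀
      regroup : ∀ x y z w → x * (y * (z * w)) ≡ z * ((x * y) * w)
      regroup = solve-∀
      regroup′ : ∀ x y z w → x * (y * (z * w)) ≡ (y * (x * z)) * w
      regroup′ = solve-∀
      collect : ∀ x y → x + y * x ≡ (1 + y) * x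
      collect = solve-∀

    after-far : ∀ m → b m ≤ k * d ^ (m ∸ suc t)
    after-far m = ≤-trans (≤-reflexive (N-split m u c')) (≤-trans (sum-mono (λ i → walkCount-bound m u (c' i))) (≤-reflexive (sum-const {k} _)))

    module A = KeyInequality t q d k Λ q1 d2q b (λ m s → Concatenation.T (copCount c') m s u)
                 (λ m s → Concatenation.T-value (copCount c') m s u) after-near after-far ≤-refl hq hk

    P' : ℕ → ℕ
    P' j = Concatenation.P (copCount c') t j u

    S-potential : S t nothing u (g c') ≡ (H * P' 0 + H * P' 1) + Λ * sumTo (t ∸ 1) (λ i → q ^ (t ∸ suc i) * P' (suc (suc i)))
    S-potential = begin-equality
      S t nothing u (g c')
        ≡⟨ S-+ t nothing u (λ y → H * (N 0 y c' + N 1 y c')) (λ y → Λ * E c' y) ⟩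
      S t nothing u (λ y → H * (N 0 y c' + N 1 y c')) + S t nothing u (λ y → Λ * E c' y)
        ≡⟨ cong₂ _+_ (trans (S-* t nothing u H _) (cong (H *_) (S-+ t nothing u _ _)))
                     (trans (S-* t nothing u Λ _) (cong (Λ *_) (trans (S-sumTo (t ∸ 1) t nothing u (λ i y → q ^ (t ∸ suc i) * N (suc (suc i)) y c'))
                                                                       (sumTo-cong (t ∸ 1) (λ i _ → S-* t nothing u (q ^ (t ∸ suc i)) _))))) ⟩
      H * (P' 0 + P' 1) + Λ * sumTo (t ∸ 1) (λ i → q ^ (t ∸ suc i) * P' (suc (suc i)))
        ≡⟨ cong (_+ Λ * sumTo (t ∸ 1) (λ i → q ^ (t ∸ suc i) * P' (suc (suc i)))) (*-distribˡ-+ H (P' 0) (P' 1)) ⟩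
      (H * P' 0 + H * P' 1) + Λ * sumTo (t ∸ 1) (λ i → q ^ (t ∸ suc i) * P' (suc (suc i))) ∎

    keyIneq-holds : S t nothing u (g c') + H * Descent.W c' H (g c') t nothing u < H * q ^ t
    keyIneq-holds = ≤-<-trans bound A.Y<Q
      where
      concat : ∀ j → P' j ≤ 2 ^ t * sumTo (suc t) (λ s → d ^ s * Concatenation.T (copCount c') (t + j) s u)
      concat j = Concatenation.concat-bound (copCount c') t j u
      bound : S t nothing u (g c') + H * Descent.W c' H (g c') t nothing u ≤ A.Y
      bound = begin
        S t nothing u (g c') + H * Descent.W c' H (g c') t nothing u
          ≡⟨ cong₂ _+_ S-potential (cong (H *_) (Descent.W-eq c' H (g c') t nothing u)) ⟩
        (H * P' 0 + H * P' 1) + Λ * sumTo (t ∸ 1) (λ i → q ^ (t ∸ suc i) * P' (suc (suc i))) + H * sumTo t (λ i → d ^ (t ∸ suc i) * b (suc i))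
          ≤⟨ +-monoˡ-≤ _ (+-mono-≤ (+-mono-≤ (*-monoʳ-≤ H (concat 0)) (*-monoʳ-≤ H (concat 1)))
                                   (*-monoʳ-≤ Λ (sumTo-mono (t ∸ 1) (λ i _ → *-monoʳ-≤ (q ^ (t ∸ suc i)) (concat (suc (suc i))))))) ⟩
        A.Y ∎

  copCount-sum : ∀ (c : Fin k → Fin n) → sum (copCount c) ≡ k
  copCount-sum c = trans (∑-comm {n} {k} (λ y i → indicator (c i) y)) (trans (sum-cong-≗ (λ i → sum-point (c i) (λ _ → 1))) (trans (sum-const {k} 1) (*-identityʳ k)))

  total-N : ∀ m (c : Fin k → Fin n) → sum (λ u → N m u c) ≤ d ^ m * k
  total-N m c = ≤-trans (total-S m (copCount c)) (≤-reflexive (cong (d ^ m *_) (copCount-sum c)))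

  X : ℕ
  X = Λ * 4 ^ t

  X-pos : 1 ≤ X
  X-pos = *-mono-≤ (degreeThreshold-pos t) (m^n>0 4 t)

  total-E : ∀ c → sum (λ u → E c u) ≤ (t ∸ 1) * (4 ^ t * k * q ^ suc t)
  total-E c = begin
    sum (λ u → sumTo (t ∸ 1) (λ i → q ^ (t ∸ suc i) * N (suc (suc i)) u c))
      ≡⟨ sum-sumTo (t ∸ 1) (λ u i → q ^ (t ∸ suc i) * N (suc (suc i)) u c) ⟩
    sumTo (t ∸ 1) (λ i → sum (λ u → q ^ (t ∸ suc i) * N (suc (suc i)) u c))
      ≤⟨ sumTo-bound (t ∸ 1) _ _ per-distance ⟩
    (t ∸ 1) * (4 ^ t * k * q ^ suc t) ∎
    where
    per-distance : ∀ i → i < t ∸ 1 → sum (λ u → q ^ (t ∸ suc i) * N (suc (suc i)) u c) ≤ 4 ^ t * k * q ^ suc t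
    per-distance i it = begin
      sum (λ u → q ^ e * N (suc (suc i)) u c)          ≡⟨ sum-* {n} (q ^ e) _ ⟩
      q ^ e * sum (λ u → N (suc (suc i)) u c)
        ≤⟨ *-monoʳ-≤ (q ^ e) (≤-trans (total-N (suc (suc i)) c) (*-monoˡ-≤ k (pow≤2^*pow d q (suc (suc i)) d2q))) ⟩
      q ^ e * (2 ^ suc (suc i) * q ^ suc (suc i) * k)  ≡⟨ regroup (q ^ e) (2 ^ suc (suc i)) (q ^ suc (suc i)) k ⟩
      2 ^ suc (suc i) * k * (q ^ e * q ^ suc (suc i))
        ≡⟨ cong (2 ^ suc (suc i) * k *_) (trans (sym (^-distribˡ-+-* q e (suc (suc i)))) (cong (q ^_) ex)) ⟩
      2 ^ suc (suc i) * k * q ^ suc t                  ≤⟨ *-monoˡ-≤ (q ^ suc t) (*-monoˡ-≤ k (2^≤4^ t (suc (suc i)) (≤-trans it2 (m≤m+n t t)))) ⟩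
      4 ^ t * k * q ^ suc t                            ∎
      where
      e = t ∸ suc i
      it2 : suc (suc i) ≤ t
      it2 = suc<∸1 i t it
      ex : e + suc (suc i) ≡ suc t
      ex = trans (+-suc e (suc i)) (cong suc (m∸n+n≡m (≤-trans (n≤1+n _) it2)))
      regroup : ∀ a b c k → a * (b * c * k) ≡ b * k * (a * c)
      regroup = solve-∀

  potential-sum : ∀ c → sum (λ u → g c u) ≤ (3 + t * X) * k * q ^ suc t
  potential-sum c = begin
    sum (λ u → H * (N 0 u c + N 1 u c) + Λ * E c u)
      ≡⟨ ∑-distrib-+ {n} _ _ ⟩
    sum (λ u → H * (N 0 u c + N 1 u c)) + sum (λ u → Λ * E c u)
      ≡⟨ cong₂ _+_ (trans (sum-* {n} H _) (cong (H *_) (∑-distrib-+ {n} _ _))) (sum-* {n} Λ _) ⟩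
    H * (sum (λ u → N 0 u c) + sum (λ u → N 1 u c)) + Λ * sum (λ u → E c u)
      ≤⟨ +-mono-≤ (*-monoʳ-≤ H (+-mono-≤ (total-N 0 c) (total-N 1 c))) (*-monoʳ-≤ Λ (total-E c)) ⟩
    H * (d ^ 0 * k + d ^ 1 * k) + Λ * ((t ∸ 1) * (4 ^ t * k * q ^ suc t))
      ≤⟨ +-mono-≤ (*-monoʳ-≤ H (+-monoʳ-≤ (d ^ 0 * k) (*-monoˡ-≤ k (≤-trans (≤-reflexive (*-identityʳ d)) d2q)))) (*-monoʳ-≤ Λ (*-monoˡ-≤ _ (m∸n≤m t 1))) ⟩
    q ^ t * (1 * k + 2 * q * k) + Λ * (t * (4 ^ t * k * q ^ suc t))
      ≤⟨ +-monoˡ-≤ _ (≤-trans (≤-reflexive (expand (q ^ t) k q)) (+-monoˡ-≤ (2 * (q * q ^ t * k)) (≤-trans (≤-reflexive (sym (*-identityˡ (q ^ t * k)))) (≤-trans (*-monoˡ-≤ (q ^ t * k) q1) (≤-reflexive (sym (*-assoc q (q ^ t) k))))))) ⟩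
    (q * q ^ t * k + 2 * (q * q ^ t * k)) + Λ * (t * (4 ^ t * k * q ^ suc t))
      ≡⟨ collect q (q ^ t) k Λ t (4 ^ t) ⟩
    (3 + t * X) * k * q ^ suc t ∎
    where
    expand : ∀ x k q → x * (1 * k + 2 * q * k) ≡ x * k + 2 * (q * x * k)
    expand = solve-∀
    collect : ∀ q x k L t f → (q * x * k + 2 * (q * x * k)) + L * (t * (f * k * (q * x))) ≡ (3 + t * (L * f)) * k * (q * x)
    collect = solve-∀

  potentialCoeff< : 1 ≤ k → (3 + t * X) * k < q ^ t
  potentialCoeff< k1 = begin-strict
    (3 + t * X) * k           <⟨ *-monoˡ-< k {{>-nonZero k1}} (≤-refl {suc (3 + t * X)}) ⟩
    (4 + t * X) * k
      ≤⟨ *-monoˡ-≤ k (≤-trans (+-monoˡ-≤ (t * X) (≤-trans (≤-reflexive (sym (*-identityʳ 4))) (*-monoʳ-≤ 4 X-pos))) (≤-trans (≤-reflexive (collect X t)) (*-monoˡ-≤ X t+4≤K0))) ⟩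
    K0 t * X * k              ≡⟨ regroup (K0 t) Λ (4 ^ t) k ⟩
    K0 t * (Λ * (4 ^ t * k))  ≤⟨ hk ⟩
    q ^ t                     ∎
    where
    collect : ∀ X t → 4 * X + t * X ≡ (t + 4) * X
    collect = solve-∀
    regroup : ∀ a b c k → a * (b * c) * k ≡ a * (b * (c * k))
    regroup = solve-∀
    expand : ∀ t → (t + 2) * (t + 2) ≡ (t + 4) + (t * t + 3 * t)
    expand = solve-∀
    t+4≤K0 : t + 4 ≤ K0 t
    t+4≤K0 = ≤-trans (m≤m+n (t + 4) (t * t + 3 * t)) (≤-reflexive (sym (expand t)))

  -- Averaging over the n ≥ q^(t+1) vertices (a ball of radius t+1 is a
  -- tree): some vertex is safe for any initial cop positions.
  safeStart : Fin n → 1 ≤ k → ∀ c → ∃[ u ] Safe u c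
  safeStart v k1 c = sum-pigeonhole (λ u → g c u) (λ _ → H) below-average
    where
    q^t+1-pos : 1 ≤ q ^ suc t
    q^t+1-pos = pow-mono q {0} {suc t} q1 z≤n
    ball : q ^ suc t ≤ n
    ball = ≤-trans (≤-reflexive (sym (*-identityʳ _))) (≤-trans (S-lower (suc t) nothing v 1) (ball≤n (suc t) nothing v ≤-refl))
    below-average : sum (λ u → g c u) < sum {n} (λ _ → H)
    below-average = begin-strict
      sum (λ u → g c u)            ≤⟨ potential-sum c ⟩
      (3 + t * X) * k * q ^ suc t  <⟨ *-monoˡ-< (q ^ suc t) {{>-nonZero q^t+1-pos}} (potentialCoeff< k1) ⟩
      q ^ t * q ^ suc t            ≤⟨ *-monoʳ-≤ (q ^ t) ball ⟩
      q ^ t * n                    ≡⟨ *-comm (q ^ t) n ⟩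
      n * H                        ≡⟨ sym (sum-const {n} H) ⟩
      sum {n} (λ _ → H)            ∎

  robberEscapes : Fin n → 1 ≤ k → ¬ CopsWin G t k
  robberEscapes v k1 = Strategy.robberWins (λ u c c' safe moved → After.keyIneq-holds u c safe c' moved) dq (safeStart v k1)

-- With no cops at all the robber survives by standing still.
noCops-lose : ∀ {n} (G : Graph n) t → Fin n → ¬ CopsWin G t 0
noCops-lose G t v (c , win) = stand c (win v)
  where
  open Game G t 0
  stand : ∀ c → CopWin c v → ⊥
  stand c (caught (() , _))
  stand c (move c' _ (inj₁ (() , _)))
  stand c (move c' _ (inj₂ next)) = stand c' (next v stay)

-- The constant of the theorem: the first summand handles graphs of large
-- degree (via the escape lemma), the second one graphs of degree ≤ Λ(t).
copConstant : ℕ → ℕ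
copConstant t = 2 ^ t * (K0 t * (degreeThreshold t * 4 ^ t)) + degreeThreshold t ^ t

copConstant-pos : ∀ t → 1 ≤ copConstant t
copConstant-pos t = ≤-trans (*-mono-≤ (m^n>0 2 t) (*-mono-≤ (posK0 t) (*-mono-≤ (degreeThreshold-pos t) (m^n>0 4 t)))) (m≤m+n _ _)

smallDegree-bound : ∀ t d k → d ≤ degreeThreshold t → 1 ≤ k → d ^ t ≤ copConstant t * k
smallDegree-bound t d k small k≥1 = begin
  d ^ t                      ≤⟨ ^-monoˡ-≤ t small ⟩
  degreeThreshold t ^ t      ≤⟨ m≤n+m _ _ ⟩
  copConstant t              ≡⟨ *-identityʳ _ ⟨
  copConstant t * 1          ≤⟨ *-monoʳ-≤ (copConstant t) k≥1 ⟩
  copConstant t * k          ∎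
  where open ≤-Reasoning

manyCops-bound : ∀ t q k → 1 ≤ q → q ^ t < K0 t * (degreeThreshold t * (4 ^ t * k)) → suc q ^ t ≤ copConstant t * k
manyCops-bound t q k q≥1 few = begin
  suc q ^ t                                           ≤⟨ pow≤2^*pow (suc q) q t (1+q≤2q q≥1) ⟩
  2 ^ t * q ^ t                                       ≤⟨ *-monoʳ-≤ (2 ^ t) (<⇒≤ few) ⟩
  2 ^ t * (K0 t * (degreeThreshold t * (4 ^ t * k)))  ≡⟨ reassoc (2 ^ t) (K0 t) (degreeThreshold t) (4 ^ t) k ⟩
  2 ^ t * (K0 t * (degreeThreshold t * 4 ^ t)) * k    ≤⟨ *-monoˡ-≤ k (m≤m+n (2 ^ t * (K0 t * (degreeThreshold t * 4 ^ t))) (degreeThreshold t ^ t)) ⟩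
  copConstant t * k                                   ∎
  where
  open ≤-Reasoning
  reassoc : ∀ a b c e k → a * (b * (c * (e * k))) ≡ a * (b * (c * e)) * k
  reassoc = solve-∀

copNumber-lower : ∀ t {n} (G : Graph n) d → Fin n → Regular G d → 2 ≤ d →
  GirthGreaterThan G (2 * t + 2) → ∀ k → CopsWin G t k → d ^ t ≤ copConstant t * k
copNumber-lower t G d v reg d≥2 girth zero win = ⊥-elim (noCops-lose G t v win)
copNumber-lower t G d@(suc q) v reg (s≤s q≥1) girth k@(suc _) win with d ≤? degreeThreshold t
... | yes small = smallDegree-bound t d k small (s≤s z≤n)
... | no big with K0 t * (degreeThreshold t * (4 ^ t * k)) ≤? q ^ t
...   | yes few = ⊥-elim (Escape.robberEscapes G d reg t girth k q refl q≥1 (≤-pred (≰⇒> big)) few v (s≤s z≤n) win)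
...   | no many = manyCops-bound t q k q≥1 (≰⇒> many)

-- The theorem: c_t = 1 / copConstant t works for every t.
mainTheorem2 : ∀ (t : ℕ) → 1 ≤ t →
    ∃[ N ] (1 ≤ N ×
      (∀ (n : ℕ) (G : Graph n) (d : ℕ) → 1 ≤ n → Connected G → Regular G d →
        3 ≤ d → t ≤ d → GirthGreaterThan G (2 * t + 2) →
        ∀ (k : ℕ) → CopsWin G t k → d ^ t ≤ N * k))
mainTheorem2 t _ = copConstant t , copConstant-pos t ,
  λ n G d n≥1 _ reg d≥3 _ girth → copNumber-lower t G d (fromℕ< n≥1) reg (≤-trans (n≤1+n 2) d≥3) girth
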